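{- Let $A$ be a non-ambiguous unit-free MALL formula. Then there is exactly one cut-free proof-net with conclusions $A^\perp,A$, namely the identity proof-net of $A$.
   Context: Unit-free MALL formulas $A::=X\mid X^\perp\mid A\otimes A\mid A⅋A\mid A\&A\mid A\oplus A$, $(A\otimes B)^\perp=B^\perp⅋A^\perp$, $(A\&B)^\perp=B^\perp\oplus A^\perp$. A formula is non-ambiguous if each atom occurs in it at most once, counting both $X$ and $X^\perp$ occurrences. Proof-nets (Hughes–van Glabbeek), cut-free case: the sequent $\Gamma$ is a forest of syntactic trees with atom occurrences as leaves. Additive resolution: delete one argument subtree of each $\&$/$\oplus$; $\&$-resolution: delete one argument of each $\&$. Link: pair of leaves labelled $X$, $X^\perp$. Linking: set of disjoint links whose leaves are exactly the leaves of an additive resolution. $\Lambda$ toggles $\&$-vertex $W$ if both premises of $W$ occur in the union of the resolutions of $\Lambda$; link $a$ depends on $W$ in $\Lambda$ if $a\in\lambda\setminus\lambda'$ for some $\lambda,\lambda'\in\Lambda$ with $W$ the only $\&$ toggled by $\{\lambda,\lambda'\}$. $\mathcal{G}_\Lambda$: union of the resolutions, the links, and jump edges $l\to W$ for leaves $l$ of links depending on $W$. Switching cycle: cycle using at most one in-edge (premise edge or jump) of each $⅋$/$\&$ vertex; $⅋$-switching of $\lambda$: delete one premise edge of each $⅋$. A cut-free proof-net on $\Gamma$ is a set $\theta$ of linkings with (P1) exactly one linking on each $\&$-resolution, (P2) each $⅋$-switching of each linking is a tree, (P3) each $\Lambda\subseteq\theta$ of size $\ge2$ toggles a $\&$ in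 no switching cycle of $\mathcal{G}_\Lambda$. Identity proof-net of $A$: translation of the fully axiom-expanded axiom proof of $\vdash A^\perp,A$ (atomic axiom $\mapsto\{\{(X,X^\perp)\}\}$; $⅋,\oplus_i$ keep the set of linkings; $\otimes$ takes all pairwise unions; $\&$ takes the union of the two sets). -}

module Defs where

open import Level using (Level; _⊔_) renaming (suc to lsuc; zero to lzero)
open import Data.Nat using (ℕ; zero; suc; _+_; _≤_)
open import Data.Bool using (Bool; true; false; if_then_else_)
open import Data.Fin using (Fin) renaming (zero to fz; suc to fs)
open import Data.List using (List; []; _∷_; _++_; map; concatMap; length; lookup)
open import Data.List.Membership.Propositional using (_∈_)
open import Data.List.Relation.Unary.Any using (Any)
open import Data.List.Relation.Unary.Unique.Propositional using (Unique)
open import Data.Product using (Σ; Σ-syntax; ∃; ∃-syntax; _×_; _,_; proj₁; proj₂)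
open import Data.Sum using (_⊎_)
open import Data.Unit using (⊤)
open import Data.Empty using (⊥)
open import Level using (Lift)
open import Relation.Nullary using (¬_)
open import Relation.Binary.PropositionalEquality using (_≡_; _≢_)
open import Relation.Nullary.Decidable using (⌊_⌋)

-- Unit-free MALL formulas.  Atoms are natural numbers;
-- pos n is the atom X_n, neg n is X_n^⊥.

data Conn : Set where
  tensor par with' plus : Conn

data Formula : Set where
  pos neg : ℕ → Formula
  bin     : Conn → Formula → Formula → Formula

dual : Formula → Formula
dual (pos n)          = neg n
dual (neg n)          = pos n
dual (bin tensor A B) = bin par    (dual B) (dual A)
dual (bin par A B)    = bin tensor (dual B) (dual A)
dual (bin with' A B)  = bin plus   (dual B) (dual A)
dual (bin plus A B)   = bin with'  (dual B) (dual A)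

occ : ℕ → Formula → ℕ
occ n (pos m)     = if ⌊ n Data.Nat.≟ m ⌋ then 1 else 0
occ n (neg m)     = if ⌊ n Data.Nat.≟ m ⌋ then 1 else 0
occ n (bin _ A B) = occ n A + occ n B

NonAmbiguous : Formula → Set
NonAmbiguous A = ∀ n → occ n A ≤ 1

data Side : Set where
  L R : Side

data Pos : Formula → Set where
  root : ∀ {A} → Pos A
  inl  : ∀ {k A B} → Pos A → Pos (bin k A B)
  inr  : ∀ {k A B} → Pos B → Pos (bin k A B)

sub : ∀ {A} → Pos A → Formula
sub {A} root = A
sub (inl p)  = sub p
sub (inr p)  = sub p

data Prem : Side → ∀ {A} → Pos A → Pos A → Set where
  topL : ∀ {k A B} → Prem L (inl {k} {A} {B} root) root
  topR : ∀ {k A B} → Prem R (inr {k} {A} {B} root) root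
  underL : ∀ {s k A B} {p q : Pos A} → Prem s p q → Prem s (inl {k} {A} {B} p) (inl q)
  underR : ∀ {s k A B} {p q : Pos B} → Prem s p q → Prem s (inr {k} {A} {B} p) (inr q)

Sequent : Set
Sequent = List Formula

record Vertex (Γ : Sequent) : Set where
  constructor vtx
  field
    index    : Fin (length Γ)
    position : Pos (lookup Γ index)

label : ∀ {Γ} → Vertex Γ → Formula
label (vtx i p) = sub p

data Premise {Γ : Sequent} (s : Side) : Vertex Γ → Vertex Γ → Set where
  prem : ∀ {i p q} → Prem s p q → Premise s (vtx i p) (vtx i q)

HasConn : Conn → Formula → Set
HasConn k A = Σ[ B ∈ Formula ] Σ[ C ∈ Formula ] A ≡ bin k B C

IsWith IsPar : ∀ {Γ} → Vertex Γ → Set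
IsWith v = HasConn with' (label v)
IsPar  v = HasConn par (label v)

IsLeaf : ∀ {Γ} → Vertex Γ → Set
IsLeaf v = Σ[ n ∈ ℕ ] (label v ≡ pos n ⊎ label v ≡ neg n)

-- A resolution is given by a choice of side at each vertex
-- (only relevant at the connectives being resolved); a vertex survives iff
-- for each proper ancestor with a resolved connective it lies in the chosen
-- argument subtree.

Additive : Conn → Set
Additive k = k ≡ with' ⊎ k ≡ plus

WithC : Conn → Set
WithC k = k ≡ with'

inSelPos : (P : Conn → Set) (A : Formula) → (Pos A → Side) → Pos A → Set
inSelPos P A           c root    = ⊤
inSelPos P (bin k A B) c (inl p) = (P k → c root ≡ L) × inSelPos P A (λ q → c (inl q)) p
inSelPos P (bin k A B) c (inr p) = (P k → c root ≡ R) × inSelPos P B (λ q → c (inr q)) p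

Choice : Sequent → Set
Choice Γ = Vertex Γ → Side

inSel : ∀ {Γ} (P : Conn → Set) → Choice Γ → Vertex Γ → Set
inSel {Γ} P c (vtx i p) = inSelPos P (lookup Γ i) (λ q → c (vtx i q)) p

inRes : ∀ {Γ} → Choice Γ → Vertex Γ → Set
inRes = inSel Additive

inWRes : ∀ {Γ} → Choice Γ → Vertex Γ → Set
inWRes = inSel WithC

-- Links and linkings.  A link is stored oriented: (u , v) with u labelled X
-- and v labelled X^⊥.  A linking is a set of links, i.e. a relation.

Linking : Sequent → Set₁
Linking Γ = Vertex Γ → Vertex Γ → Set

_≈_ : ∀ {Γ} → Linking Γ → Linking Γ → Set
λ₁ ≈ λ₂ = ∀ u v → (λ₁ u v → λ₂ u v) × (λ₂ u v → λ₁ u v)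

LeafOf : ∀ {Γ} → Linking Γ → Vertex Γ → Set
LeafOf λ₁ x = (∃[ y ] λ₁ x y) ⊎ (∃[ y ] λ₁ y x)

ResolutionOf : ∀ {Γ} → Linking Γ → Choice Γ → Set
ResolutionOf λ₁ c = ∀ x → ((IsLeaf x × inRes c x) → LeafOf λ₁ x) × (LeafOf λ₁ x → (IsLeaf x × inRes c x))

record IsLinking {Γ} (λ₁ : Linking Γ) : Set where
  field
    links    : ∀ u v → λ₁ u v → Σ[ n ∈ ℕ ] (label u ≡ pos n × label v ≡ neg n)
    disjoint₁ : ∀ u v v' → λ₁ u v → λ₁ u v' → v ≡ v'
    disjoint₂ : ∀ u u' v → λ₁ u v → λ₁ u' v → u ≡ u'
    resolution : Σ[ c ∈ Choice Γ ] ResolutionOf λ₁ c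

inResOf : ∀ {Γ} → Linking Γ → Vertex Γ → Set
inResOf λ₁ v = Σ[ c ∈ _ ] (ResolutionOf λ₁ c × inRes c v)

-- Graphs on the vertices of a sequent: edges are tree (premise) edges
-- (child , parent), link edges (X-leaf , X^⊥-leaf), jump edges (leaf , &-vertex).

data EKind : Set where
  treeE linkE jumpE : EKind

Edge : Sequent → Set
Edge Γ = EKind × Vertex Γ × Vertex Γ

Connects : ∀ {Γ} → Edge Γ → Vertex Γ → Vertex Γ → Set
Connects (_ , a , b) u v = (a ≡ u × b ≡ v) ⊎ (a ≡ v × b ≡ u)

InEdge : ∀ {Γ} → Edge Γ → Vertex Γ → Set
InEdge (treeE , a , b) w = b ≡ w
InEdge (linkE , a , b) w = ⊥
InEdge (jumpE , a , b) w = b ≡ w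

module _ {Γ : Sequent} (E : Edge Γ → Set₁) where

  data Walk : Vertex Γ → Vertex Γ → Set₁ where
    []  : ∀ {v} → Walk v v
    _∷_ : ∀ {u v w} → (Σ[ e ∈ Edge Γ ] (E e × Connects e u v)) → Walk v w → Walk u w

  edges : ∀ {u w} → Walk u w → List (Edge Γ)
  edges []              = []
  edges ((e , _) ∷ ws)  = e ∷ edges ws

  -- the vertices a walk departs from (for a closed walk: each vertex of it once)
  verts : ∀ {u w} → Walk u w → List (Vertex Γ)
  verts [] = []
  verts {u} (_ ∷ ws) = u ∷ verts ws

  record Cycle : Set₁ where
    field
      start    : Vertex Γ
      walk     : Walk start start
      nonempty : 1 ≤ length (edges walk)
      uniqE    : Unique (edges walk)
      uniqV    : Unique (verts walk)

  Connected : (V : Vertex Γ → Set₁) → Set₁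
  Connected V = ∀ u v → V u → V v → Walk u v

  IsTree : (V : Vertex Γ → Set₁) → Set₁
  IsTree V = Connected V × ¬ Cycle

  record SwitchingCycle : Set₁ where
    field
      cycle : Cycle
      switching : ∀ w → (IsPar w ⊎ IsWith w) → ∀ e e'
                  → e ∈ edges (Cycle.walk cycle) → e' ∈ edges (Cycle.walk cycle)
                  → InEdge e w → InEdge e' w → e ≡ e'

  OnCycle : Vertex Γ → SwitchingCycle → Set
  OnCycle w C = w ∈ verts (Cycle.walk (SwitchingCycle.cycle C))

ParSwitching : Sequent → Set
ParSwitching Γ = Vertex Γ → Side

resVerts : ∀ {Γ} → Linking Γ → Vertex Γ → Set₁
resVerts λ₁ v = Lift _ (inResOf λ₁ v)

switchEdges : ∀ {Γ} → Linking Γ → ParSwitching Γ → Edge Γ → Set₁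
switchEdges λ₁ s (treeE , a , b) =
  Lift _ (Σ[ t ∈ Side ] (Premise t a b × inResOf λ₁ a × ¬ (IsPar b × s b ≡ t)))
switchEdges λ₁ s (linkE , a , b) = Lift _ (λ₁ a b)
switchEdges λ₁ s (jumpE , a , b) = Lift _ ⊥

LinkingSet : Sequent → Set₂
LinkingSet Γ = Linking Γ → Set₁

module _ {Γ : Sequent} (Λ : LinkingSet Γ) where

  inUnion : Vertex Γ → Set₁
  inUnion v = Σ[ λ₁ ∈ Linking Γ ] (Λ λ₁ × inResOf λ₁ v)

  Toggles : Vertex Γ → Set₁
  Toggles W = IsWith W × (∀ t → Σ[ p ∈ Vertex Γ ] (Premise t p W × inUnion p))

pairSet : ∀ {Γ} → Linking Γ → Linking Γ → LinkingSet Γ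
pairSet λ₁ λ₂ x = (x ≡ λ₁) ⊎ (x ≡ λ₂)

module _ {Γ : Sequent} (Λ : LinkingSet Γ) where

  Depends : Vertex Γ → Vertex Γ → Vertex Γ → Set₁
  Depends u v W = Σ[ λ₁ ∈ Linking Γ ] Σ[ λ₂ ∈ Linking Γ ]
    (Λ λ₁ × Λ λ₂ × λ₁ u v × ¬ λ₂ u v
     × Toggles (pairSet λ₁ λ₂) W
     × (∀ W' → Toggles (pairSet λ₁ λ₂) W' → W' ≡ W))

  GEdges : Edge Γ → Set₁
  GEdges (treeE , a , b) = Σ[ t ∈ Side ] (Lift (lsuc lzero) (Premise t a b) × inUnion Λ a)
  GEdges (linkE , a , b) = Σ[ λ₁ ∈ Linking Γ ] (Λ λ₁ × Lift (lsuc lzero) (λ₁ a b))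
  GEdges (jumpE , l , W) = Σ[ u ∈ Vertex Γ ] Σ[ v ∈ Vertex Γ ]
                             (Depends u v W × Lift (lsuc lzero) (l ≡ u ⊎ l ≡ v))

OnWRes : ∀ {Γ} → Linking Γ → Choice Γ → Set
OnWRes λ₁ c = ∀ x → LeafOf λ₁ x → inWRes c x

_⊆_ : ∀ {Γ} → LinkingSet Γ → LinkingSet Γ → Set₁
Λ ⊆ θ = ∀ λ₁ → Λ λ₁ → Σ[ λ₂ ∈ Linking _ ] (θ λ₂ × λ₁ ≈ λ₂)

_≐_ : ∀ {Γ} → LinkingSet Γ → LinkingSet Γ → Set₁
θ ≐ θ' = (θ ⊆ θ') × (θ' ⊆ θ)

record IsProofNet (Γ : Sequent) (θ : LinkingSet Γ) : Set₂ where
  field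
    linkings : ∀ λ₁ → θ λ₁ → IsLinking λ₁
    P1 : ∀ (c : Choice Γ) → Σ[ λ₁ ∈ Linking Γ ]
           (θ λ₁ × OnWRes λ₁ c × (∀ λ₂ → θ λ₂ → OnWRes λ₂ c → λ₂ ≈ λ₁))
    P2 : ∀ λ₁ → θ λ₁ → ∀ (s : ParSwitching Γ) → IsTree (switchEdges λ₁ s) (resVerts λ₁)
    P3 : ∀ (Λ : LinkingSet Γ) → Λ ⊆ θ
         → (Σ[ λ₁ ∈ Linking Γ ] Σ[ λ₂ ∈ Linking Γ ] (Λ λ₁ × Λ λ₂ × ¬ (λ₁ ≈ λ₂)))
         → Σ[ W ∈ Vertex Γ ] (Toggles Λ W
              × ((C : SwitchingCycle (GEdges Λ)) → ¬ OnCycle (GEdges Λ) W C))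

idSeq : Formula → Sequent
idSeq A = dual A ∷ A ∷ []

-- proto-linkings: lists of pairs (leaf of A , leaf of A^⊥)
IdL : Formula → Set
IdL A = List (Pos A × Pos (dual A))

pmap : ∀ {A B C D} → (Pos A → Pos C) → (Pos B → Pos D) → List (Pos A × Pos B) → List (Pos C × Pos D)
pmap f g = map (λ (q , p) → (f q , g p))

-- translation of the fully axiom-expanded axiom proof of ⊢ A^⊥, A
idLinkings : (A : Formula) → List (IdL A)
idLinkings (pos n) = ((root , root) ∷ []) ∷ []
idLinkings (neg n) = ((root , root) ∷ []) ∷ []
idLinkings (bin tensor B C) =   -- ⅋ on A^⊥ = C^⊥ ⅋ B^⊥, then ⊗ : all pairwise unions
  concatMap (λ l → map (λ m → pmap inl inr l ++ pmap inr inl m) (idLinkings C)) (idLinkings B)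
idLinkings (bin par B C) =      -- ⅋ on A, then ⊗ on A^⊥ = C^⊥ ⊗ B^⊥
  concatMap (λ l → map (λ m → pmap inl inr l ++ pmap inr inl m) (idLinkings C)) (idLinkings B)
idLinkings (bin with' B C) =    -- & on A, then ⊕ on A^⊥ = C^⊥ ⊕ B^⊥ : union
  map (pmap inl inr) (idLinkings B) ++ map (pmap inr inl) (idLinkings C)
idLinkings (bin plus B C) =     -- & on A^⊥ = C^⊥ & B^⊥, then ⊕ on A : union
  map (pmap inl inr) (idLinkings B) ++ map (pmap inr inl) (idLinkings C)

isPos : Formula → Bool
isPos (pos _) = true
isPos _       = false

orient : ∀ {A} → Pos A × Pos (dual A) → Vertex (idSeq A) × Vertex (idSeq A)
orient (q , p) = if isPos (sub q) then (vtx (fs fz) q , vtx fz p) else (vtx fz p , vtx (fs fz) q)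

toLinking : ∀ {A} → IdL A → Linking (idSeq A)
toLinking l u v = (u , v) ∈ map orient l

IdNet : (A : Formula) → LinkingSet (idSeq A)
IdNet A λ₁ = Lift _ (Any (λ l → λ₁ ≈ toLinking l) (idLinkings A))

module Submission where

-- Additive resolutions r of A (a side at each & and ⊕) index the identity net: its linkings are the
-- axiom linkings idLinking r, joining each leaf of r in A to its mirror image in A^⊥, and the resolution
-- of idLinking r is r on A and its dual on A^⊥. (P1) An &-resolution of A^⊥, A fixes the & choices of A
-- and, through A^⊥, its ⊕ choices: the-link-edge r. (P2) A switching graph is connected, the two copies of every
-- position being joined through a child kept by the switching; it is acyclic, since a cycle lying above a
-- position p lies above the-link-edge child of p: the switched copy of p is off the cycle and the other copy offers
-- a single edge into each subtree. (P3) Two resolutions first diverge at an additive position whose & copy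
-- is toggled; jumps go from leaves down to & vertices, so the same descent keeps it off switching cycles.
-- Uniqueness: if every atom occurs once in A, a link of any linking joins a leaf of A to its own mirror
-- image, so every linking is an axiom linking, and (P1) then pins down the whole net.

open import Defs
open import Level using (Lift; lift) renaming (suc to lsuc; zero to lzero)
open import Data.Nat using (ℕ; _≤_; z≤n; s≤s; _≟_)
open import Data.Nat.Properties using (≤-trans; m≤m+n; m≤n+m; +-mono-≤; +-comm)
open import Data.Bool using (if_then_else_)
open import Data.Fin using () renaming (zero to fz; suc to fs)
open import Data.List using (List; []; _∷_; _++_; map; concatMap; length; lookup)
open import Data.List.Membership.Propositional using (_∈_; find; lose)
open import Data.List.Membership.Propositional.Properties using (∈-map⁺; ∈-map⁻; ∈-++⁺ˡ; ∈-++⁺ʳ; ∈-++⁻; ∈-concatMap⁺; ∈-concatMap⁻)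
open import Data.List.Relation.Unary.Any using (here; there)
open import Data.List.Relation.Unary.All using () renaming (lookup to Alookup)
open import Data.List.Relation.Unary.AllPairs using (_∷_)
open import Data.List.Relation.Unary.Unique.Propositional using (Unique)
open import Data.Product using (Σ-syntax; _×_; _,_; proj₁; proj₂) renaming (map to ×-map)
open import Data.Sum using (_⊎_; inj₁; inj₂)
open import Data.Unit using (⊤; tt)
open import Data.Empty using (⊥; ⊥-elim)
open import Relation.Nullary using (¬_; Dec; yes; no)
open import Relation.Nullary.Decidable using (⌊_⌋)
open import Relation.Binary.Definitions using (DecidableEquality)
open import Relation.Binary.PropositionalEquality

-- Sides, positions and mirroring

flipSide : Side → Side
flipSide L = R
flipSide R = L

flipSide-involutive : ∀ s → flipSide (flipSide s) ≡ s
flipSide-involutive L = refl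
flipSide-involutive R = refl

Side≟ : (a b : Side) → Dec (a ≡ b)
Side≟ L L = yes refl
Side≟ R R = yes refl
Side≟ L R = no λ ()
Side≟ R L = no λ ()

flipSide-≢ : ∀ x → flipSide x ≢ x
flipSide-≢ L ()
flipSide-≢ R ()

≢⇒flipSide : ∀ {t t'} → t' ≢ t → t' ≡ flipSide t
≢⇒flipSide {L} {L} ne = ⊥-elim (ne refl)
≢⇒flipSide {L} {R} ne = refl
≢⇒flipSide {R} {L} ne = refl
≢⇒flipSide {R} {R} ne = ⊥-elim (ne refl)

≢-same⇒≡ : ∀ {t t' s : Side} → t ≢ s → t' ≢ s → t ≡ t'
≢-same⇒≡ {L} {L} a b = refl
≢-same⇒≡ {R} {R} a b = refl
≢-same⇒≡ {L} {R} {L} a b = ⊥-elim (a refl)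
≢-same⇒≡ {L} {R} {R} a b = ⊥-elim (b refl)
≢-same⇒≡ {R} {L} {L} a b = ⊥-elim (b refl)
≢-same⇒≡ {R} {L} {R} a b = ⊥-elim (a refl)

mirror : ∀ {A} → Pos A → Pos (dual A)
mirror {pos n} root = root
mirror {neg n} root = root
mirror {bin k B C} root = root
mirror {bin tensor B C} (inl p) = inr (mirror p)
mirror {bin tensor B C} (inr p) = inl (mirror p)
mirror {bin par B C} (inl p) = inr (mirror p)
mirror {bin par B C} (inr p) = inl (mirror p)
mirror {bin with' B C} (inl p) = inr (mirror p)
mirror {bin with' B C} (inr p) = inl (mirror p)
mirror {bin plus B C} (inl p) = inr (mirror p)
mirror {bin plus B C} (inr p) = inl (mirror p)

unmirror : ∀ {A} → Pos (dual A) → Pos A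
unmirror {pos n} root = root
unmirror {neg n} root = root
unmirror {bin tensor B C} root = root
unmirror {bin tensor B C} (inl p) = inr (unmirror p)
unmirror {bin tensor B C} (inr p) = inl (unmirror p)
unmirror {bin par B C} root = root
unmirror {bin par B C} (inl p) = inr (unmirror p)
unmirror {bin par B C} (inr p) = inl (unmirror p)
unmirror {bin with' B C} root = root
unmirror {bin with' B C} (inl p) = inr (unmirror p)
unmirror {bin with' B C} (inr p) = inl (unmirror p)
unmirror {bin plus B C} root = root
unmirror {bin plus B C} (inl p) = inr (unmirror p)
unmirror {bin plus B C} (inr p) = inl (unmirror p)

unmirror-mirror : ∀ {A} (p : Pos A) → unmirror (mirror p) ≡ p
unmirror-mirror {pos n} root = refl
unmirror-mirror {neg n} root = refl
unmirror-mirror {bin tensor B C} root = refl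
unmirror-mirror {bin par B C} root = refl
unmirror-mirror {bin with' B C} root = refl
unmirror-mirror {bin plus B C} root = refl
unmirror-mirror {bin tensor B C} (inl p) = cong inl (unmirror-mirror p)
unmirror-mirror {bin tensor B C} (inr p) = cong inr (unmirror-mirror p)
unmirror-mirror {bin par B C} (inl p) = cong inl (unmirror-mirror p)
unmirror-mirror {bin par B C} (inr p) = cong inr (unmirror-mirror p)
unmirror-mirror {bin with' B C} (inl p) = cong inl (unmirror-mirror p)
unmirror-mirror {bin with' B C} (inr p) = cong inr (unmirror-mirror p)
unmirror-mirror {bin plus B C} (inl p) = cong inl (unmirror-mirror p)
unmirror-mirror {bin plus B C} (inr p) = cong inr (unmirror-mirror p)

mirror-unmirror : ∀ {A} (p : Pos (dual A)) → mirror {A} (unmirror p) ≡ p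
mirror-unmirror {pos n} root = refl
mirror-unmirror {neg n} root = refl
mirror-unmirror {bin tensor B C} root = refl
mirror-unmirror {bin tensor B C} (inl p) = cong inl (mirror-unmirror {C} p)
mirror-unmirror {bin tensor B C} (inr p) = cong inr (mirror-unmirror {B} p)
mirror-unmirror {bin par B C} root = refl
mirror-unmirror {bin par B C} (inl p) = cong inl (mirror-unmirror {C} p)
mirror-unmirror {bin par B C} (inr p) = cong inr (mirror-unmirror {B} p)
mirror-unmirror {bin with' B C} root = refl
mirror-unmirror {bin with' B C} (inl p) = cong inl (mirror-unmirror {C} p)
mirror-unmirror {bin with' B C} (inr p) = cong inr (mirror-unmirror {B} p)
mirror-unmirror {bin plus B C} root = refl
mirror-unmirror {bin plus B C} (inl p) = cong inl (mirror-unmirror {C} p)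
mirror-unmirror {bin plus B C} (inr p) = cong inr (mirror-unmirror {B} p)

sub-mirror : ∀ {A} (p : Pos A) → sub (mirror p) ≡ dual (sub p)
sub-mirror {pos n} root = refl
sub-mirror {neg n} root = refl
sub-mirror {bin k B C} root = refl
sub-mirror {bin tensor B C} (inl p) = sub-mirror p
sub-mirror {bin tensor B C} (inr p) = sub-mirror p
sub-mirror {bin par B C} (inl p) = sub-mirror p
sub-mirror {bin par B C} (inr p) = sub-mirror p
sub-mirror {bin with' B C} (inl p) = sub-mirror p
sub-mirror {bin with' B C} (inr p) = sub-mirror p
sub-mirror {bin plus B C} (inl p) = sub-mirror p
sub-mirror {bin plus B C} (inr p) = sub-mirror p

data _≼_ : {A : Formula} → Pos A → Pos A → Set where
  ≼root : ∀ {A} {q : Pos A} → root ≼ q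
  ≼l : ∀ {k B C} {p q : Pos B} → p ≼ q → _≼_ {bin k B C} (inl p) (inl q)
  ≼r : ∀ {k B C} {p q : Pos C} → p ≼ q → _≼_ {bin k B C} (inr p) (inr q)

≼-refl : ∀ {A} {p : Pos A} → p ≼ p
≼-refl {p = root} = ≼root
≼-refl {p = inl p} = ≼l ≼-refl
≼-refl {p = inr p} = ≼r ≼-refl

≼-trans : ∀ {A} {p q r : Pos A} → p ≼ q → q ≼ r → p ≼ r
≼-trans ≼root _ = ≼root
≼-trans (≼l a) (≼l b) = ≼l (≼-trans a b)
≼-trans (≼r a) (≼r b) = ≼r (≼-trans a b)

≼-dec : ∀ {A} (p q : Pos A) → Dec (p ≼ q)
≼-dec root q = yes ≼root
≼-dec (inl p) root = no λ ()
≼-dec (inl p) (inl q) with ≼-dec p q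
... | yes a = yes (≼l a)
... | no a = no λ { (≼l b) → a b }
≼-dec (inl p) (inr q) = no λ ()
≼-dec (inr p) root = no λ ()
≼-dec (inr p) (inl q) = no λ ()
≼-dec (inr p) (inr q) with ≼-dec p q
... | yes a = yes (≼r a)
... | no a = no λ { (≼r b) → a b }

≼-antisym : ∀ {A} {p q : Pos A} → p ≼ q → q ≼ p → p ≡ q
≼-antisym ≼root ≼root = refl
≼-antisym (≼l a) (≼l b) = cong inl (≼-antisym a b)
≼-antisym (≼r a) (≼r b) = cong inr (≼-antisym a b)

Pos-≡-dec : ∀ {A} (p q : Pos A) → Dec (p ≡ q)
Pos-≡-dec p q with ≼-dec p q | ≼-dec q p
... | yes a | yes b = yes (≼-antisym a b)
... | no a | _ = no λ { refl → a ≼-refl }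
... | _ | no b = no λ { refl → b ≼-refl }

IsBin : Formula → Set
IsBin F = Σ[ k ∈ Conn ] Σ[ B ∈ Formula ] Σ[ C ∈ Formula ] F ≡ bin k B C

IsAtom : Formula → Set
IsAtom F = Σ[ n ∈ ℕ ] (F ≡ pos n ⊎ F ≡ neg n)

IsBin⇒¬IsAtom : ∀ {F} → IsBin F → ¬ IsAtom F
IsBin⇒¬IsAtom (_ , _ , _ , refl) (_ , inj₁ ())
IsBin⇒¬IsAtom (_ , _ , _ , refl) (_ , inj₂ ())

bin-¬IsAtom : ∀ {k B C} → ¬ IsAtom (bin k B C)
bin-¬IsAtom = IsBin⇒¬IsAtom (_ , _ , _ , refl)

-- Junk value: the "child" of an atom is the atom itself.
rootChild : Side → ∀ {A} → Pos A
rootChild L {bin k B C} = inl root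
rootChild R {bin k B C} = inr root
rootChild s {pos n} = root
rootChild s {neg n} = root

child : Side → ∀ {A} → Pos A → Pos A
child s (inl p) = inl (child s p)
child s (inr p) = inr (child s p)
child s root = rootChild s

Prem⇒≡child : ∀ {t A} {x y : Pos A} → Prem t x y → x ≡ child t y
Prem⇒≡child topL = refl
Prem⇒≡child topR = refl
Prem⇒≡child (underL pr) = cong inl (Prem⇒≡child pr)
Prem⇒≡child (underR pr) = cong inr (Prem⇒≡child pr)

Prem⇒IsBin : ∀ {t A} {x y : Pos A} → Prem t x y → IsBin (sub y)
Prem⇒IsBin (topL {k} {B} {C}) = k , B , C , refl
Prem⇒IsBin (topR {k} {B} {C}) = k , B , C , refl
Prem⇒IsBin (underL pr) = Prem⇒IsBin pr
Prem⇒IsBin (underR pr) = Prem⇒IsBin pr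

child-Prem : ∀ t {A} (y : Pos A) → IsBin (sub y) → Prem t (child t y) y
child-Prem L {bin k B C} root _ = topL
child-Prem R {bin k B C} root _ = topR
child-Prem t {pos n} root (_ , _ , _ , ())
child-Prem t {neg n} root (_ , _ , _ , ())
child-Prem t (inl y) b = underL (child-Prem t y b)
child-Prem t (inr y) b = underR (child-Prem t y b)

sub-children : ∀ {A} (y : Pos A) {k B C} → sub y ≡ bin k B C → sub (child L y) ≡ B × sub (child R y) ≡ C
sub-children {bin k B C} root refl = refl , refl
sub-children {pos n} root ()
sub-children {neg n} root ()
sub-children (inl y) e = sub-children y e
sub-children (inr y) e = sub-children y e

≼-child : ∀ t {A} (p : Pos A) → p ≼ child t p
≼-child L {bin k B C} root = ≼root
≼-child R {bin k B C} root = ≼root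
≼-child t {pos n} root = ≼root
≼-child t {neg n} root = ≼root
≼-child t (inl p) = ≼l (≼-child t p)
≼-child t (inr p) = ≼r (≼-child t p)

child⋠ : ∀ t {A} (p : Pos A) → IsBin (sub p) → ¬ (child t p ≼ p)
child⋠ L {bin k B C} root _ ()
child⋠ R {bin k B C} root _ ()
child⋠ t {pos n} root (_ , _ , _ , ())
child⋠ t {neg n} root (_ , _ , _ , ())
child⋠ t (inl p) b (≼l x) = child⋠ t p b x
child⋠ t (inr p) b (≼r x) = child⋠ t p b x

children⇒¬IsBin : ∀ {A} (p : Pos A) {q} → child L p ≼ q → child R p ≼ q → ¬ IsBin (sub p)
children⇒¬IsBin {bin k B C} root (≼l _) () b
children⇒¬IsBin {pos n} root _ _ (_ , _ , _ , ())
children⇒¬IsBin {neg n} root _ _ (_ , _ , _ , ())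
children⇒¬IsBin (inl p) (≼l a) (≼l b) = children⇒¬IsBin p a b
children⇒¬IsBin (inr p) (≼r a) (≼r b) = children⇒¬IsBin p a b

≼-split : ∀ {A} {p q : Pos A} → p ≼ q → q ≡ p ⊎ (IsBin (sub p) × (child L p ≼ q ⊎ child R p ≼ q))
≼-split {bin k B C} {root} {root} ≼root = inj₁ refl
≼-split {bin k B C} {root} {inl q} ≼root = inj₂ ((k , B , C , refl) , inj₁ (≼l ≼root))
≼-split {bin k B C} {root} {inr q} ≼root = inj₂ ((k , B , C , refl) , inj₂ (≼r ≼root))
≼-split {pos n} {root} {root} ≼root = inj₁ refl
≼-split {neg n} {root} {root} ≼root = inj₁ refl
≼-split (≼l a) with ≼-split a
... | inj₁ e = inj₁ (cong inl e)
... | inj₂ (b , inj₁ x) = inj₂ (b , inj₁ (≼l x))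
... | inj₂ (b , inj₂ x) = inj₂ (b , inj₂ (≼l x))
≼-split (≼r a) with ≼-split a
... | inj₁ e = inj₁ (cong inr e)
... | inj₂ (b , inj₁ x) = inj₂ (b , inj₁ (≼r x))
... | inj₂ (b , inj₂ x) = inj₂ (b , inj₂ (≼r x))

atom-maximal : ∀ {A} {p q : Pos A} → IsAtom (sub p) → p ≼ q → q ≡ p
atom-maximal at a with ≼-split a
... | inj₁ e = e
... | inj₂ (b , _) = ⊥-elim (IsBin⇒¬IsAtom b at)

mirror-root : ∀ {A} → mirror {A} root ≡ root
mirror-root {pos n} = refl
mirror-root {neg n} = refl
mirror-root {bin k B C} = refl

mirror-child : ∀ t {A} (p : Pos A) → mirror (child t p) ≡ child (flipSide t) (mirror p)
mirror-child L {bin tensor B C} root = cong inr (mirror-root {B})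
mirror-child R {bin tensor B C} root = cong inl (mirror-root {C})
mirror-child L {bin par B C} root = cong inr (mirror-root {B})
mirror-child R {bin par B C} root = cong inl (mirror-root {C})
mirror-child L {bin with' B C} root = cong inr (mirror-root {B})
mirror-child R {bin with' B C} root = cong inl (mirror-root {C})
mirror-child L {bin plus B C} root = cong inr (mirror-root {B})
mirror-child R {bin plus B C} root = cong inl (mirror-root {C})
mirror-child L {pos n} root = refl
mirror-child R {pos n} root = refl
mirror-child L {neg n} root = refl
mirror-child R {neg n} root = refl
mirror-child t {bin tensor B C} (inl p) = cong inr (mirror-child t p)
mirror-child t {bin tensor B C} (inr p) = cong inl (mirror-child t p)
mirror-child t {bin par B C} (inl p) = cong inr (mirror-child t p)
mirror-child t {bin par B C} (inr p) = cong inl (mirror-child t p)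
mirror-child t {bin with' B C} (inl p) = cong inr (mirror-child t p)
mirror-child t {bin with' B C} (inr p) = cong inl (mirror-child t p)
mirror-child t {bin plus B C} (inl p) = cong inr (mirror-child t p)
mirror-child t {bin plus B C} (inr p) = cong inl (mirror-child t p)

mirror-≼ : ∀ {A} {p q : Pos A} → p ≼ q → mirror p ≼ mirror q
mirror-≼ {pos n} ≼root = ≼root
mirror-≼ {neg n} ≼root = ≼root
mirror-≼ {bin k B C} ≼root = ≼root
mirror-≼ {bin tensor B C} (≼l a) = ≼r (mirror-≼ a)
mirror-≼ {bin tensor B C} (≼r a) = ≼l (mirror-≼ a)
mirror-≼ {bin par B C} (≼l a) = ≼r (mirror-≼ a)
mirror-≼ {bin par B C} (≼r a) = ≼l (mirror-≼ a)
mirror-≼ {bin with' B C} (≼l a) = ≼r (mirror-≼ a)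
mirror-≼ {bin with' B C} (≼r a) = ≼l (mirror-≼ a)
mirror-≼ {bin plus B C} (≼l a) = ≼r (mirror-≼ a)
mirror-≼ {bin plus B C} (≼r a) = ≼l (mirror-≼ a)

unmirror-≼ : ∀ {A} {p q : Pos (dual A)} → p ≼ q → unmirror {A} p ≼ unmirror q
unmirror-≼ {pos n} ≼root = ≼root
unmirror-≼ {neg n} ≼root = ≼root
unmirror-≼ {bin tensor B C} ≼root = ≼root
unmirror-≼ {bin par B C} ≼root = ≼root
unmirror-≼ {bin with' B C} ≼root = ≼root
unmirror-≼ {bin plus B C} ≼root = ≼root
unmirror-≼ {bin tensor B C} (≼l a) = ≼r (unmirror-≼ {C} a)
unmirror-≼ {bin tensor B C} (≼r a) = ≼l (unmirror-≼ {B} a)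
unmirror-≼ {bin par B C} (≼l a) = ≼r (unmirror-≼ {C} a)
unmirror-≼ {bin par B C} (≼r a) = ≼l (unmirror-≼ {B} a)
unmirror-≼ {bin with' B C} (≼l a) = ≼r (unmirror-≼ {C} a)
unmirror-≼ {bin with' B C} (≼r a) = ≼l (unmirror-≼ {B} a)
unmirror-≼ {bin plus B C} (≼l a) = ≼r (unmirror-≼ {C} a)
unmirror-≼ {bin plus B C} (≼r a) = ≼l (unmirror-≼ {B} a)

-- Walks and cycles

Unique-++⇒disjoint : ∀ {a} {X : Set a} (xs : List X) {ys : List X} {x y : X} → Unique (xs ++ ys) → x ∈ xs → y ∈ ys → x ≢ y
Unique-++⇒disjoint (a ∷ xs) (px ∷ u) (here refl) y∈ = Alookup px (∈-++⁺ʳ xs y∈)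
Unique-++⇒disjoint (a ∷ xs) (px ∷ u) (there x∈) y∈ = Unique-++⇒disjoint xs u x∈ y∈

module _ {Γ : Sequent} where

  Connects-sym : ∀ {e : Edge Γ} {u v} → Connects e u v → Connects e v u
  Connects-sym (inj₁ x) = inj₂ x
  Connects-sym (inj₂ x) = inj₁ x

  Connects-unique : ∀ {e : Edge Γ} {x y u v} → Connects e x y → Connects e u v → (x ≡ u × y ≡ v) ⊎ (x ≡ v × y ≡ u)
  Connects-unique (inj₁ (refl , refl)) (inj₁ (refl , refl)) = inj₁ (refl , refl)
  Connects-unique (inj₁ (refl , refl)) (inj₂ (refl , refl)) = inj₂ (refl , refl)
  Connects-unique (inj₂ (refl , refl)) (inj₁ (refl , refl)) = inj₂ (refl , refl)
  Connects-unique (inj₂ (refl , refl)) (inj₂ (refl , refl)) = inj₁ (refl , refl)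

  module Walks (E : Edge Γ → Set₁) where

    infixr 5 _++ʷ_

    reverse-onto : ∀ {u v w} → Walk E v u → Walk E v w → Walk E u w
    reverse-onto [] acc = acc
    reverse-onto ((e , Ee , c) ∷ ws) acc = reverse-onto ws ((e , Ee , Connects-sym {e = e} c) ∷ acc)

    reverse : ∀ {u v} → Walk E u v → Walk E v u
    reverse w = reverse-onto w []

    _++ʷ_ : ∀ {u v w} → Walk E u v → Walk E v w → Walk E u w
    [] ++ʷ w2 = w2
    (s ∷ w1) ++ʷ w2 = s ∷ (w1 ++ʷ w2)

    single : ∀ {u v} (e : Edge Γ) → E e → Connects e u v → Walk E u v
    single e Ee c = (e , Ee , c) ∷ []

    splitAt : ∀ {u z y} (w : Walk E u z) → y ∈ verts E w →
             Σ[ w1 ∈ Walk E u y ] Σ[ w2 ∈ Walk E y z ] (edges E w ≡ edges E w1 ++ edges E w2)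
    splitAt (s ∷ w) (here refl) = [] , (s ∷ w) , refl
    splitAt ((e , x) ∷ w) (there y∈) with splitAt w y∈
    ... | w1 , w2 , eq = ((e , x) ∷ w1) , w2 , cong (e ∷_) eq

    private
      next∈ : ∀ {u v z} {s} (w : Walk E v z) → (v ∈ verts E (_∷_ {u = u} s w) ⊎ v ≡ z)
      next∈ [] = inj₂ refl
      next∈ (_ ∷ _) = inj₁ (there (here refl))

    edge-endpoints∈ : ∀ {u z} (w : Walk E u z) {e} → e ∈ edges E w → ∀ {x y} → Connects e x y →
                (x ∈ verts E w ⊎ x ≡ z) × (y ∈ verts E w ⊎ y ≡ z)
    edge-endpoints∈ ((e , Ee , c) ∷ w) (here refl) c' with Connects-unique {e = e} c' c
    ... | inj₁ (refl , refl) = inj₁ (here refl) , next∈ {s = e , Ee , c} w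
    ... | inj₂ (refl , refl) = next∈ {s = e , Ee , c} w , inj₁ (here refl)
    edge-endpoints∈ {z = z} (s ∷ w) (there e∈) c' with edge-endpoints∈ w e∈ c'
    ... | a , b = th a , th b
      where th : ∀ {x} → (x ∈ verts E w ⊎ x ≡ z) → (x ∈ verts E (s ∷ w) ⊎ x ≡ z)
            th (inj₁ x) = inj₁ (there x)
            th (inj₂ x) = inj₂ x

    cycle-edge-endpoints∈ : ∀ {u} (w : Walk E u u) → 1 ≤ length (edges E w) → ∀ {e} → e ∈ edges E w → ∀ {x y} → Connects e x y →
                  x ∈ verts E w × y ∈ verts E w
    cycle-edge-endpoints∈ [] () _ _
    cycle-edge-endpoints∈ {u} w@(_ ∷ _) _ e∈ c with edge-endpoints∈ w e∈ c
    ... | a , b = f a , f b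
      where f : ∀ {x} → (x ∈ verts E w ⊎ x ≡ u) → x ∈ verts E w
            f (inj₁ x) = x
            f (inj₂ refl) = here refl

    vertex-edge : ∀ {u z} (w : Walk E u z) {v} → v ∈ verts E w →
                  Σ[ e ∈ Edge Γ ] (e ∈ edges E w × E e × Σ[ y ∈ Vertex Γ ] Lift (lsuc lzero) (Connects e v y))
    vertex-edge ((e , Ee , c) ∷ w) (here refl) = e , here refl , Ee , _ , lift c
    vertex-edge (_ ∷ w) (there v∈) with vertex-edge w v∈
    ... | e , e∈ , Ee , y , c = e , there e∈ , Ee , y , c

    module _ (P : Vertex Γ → Set) (P? : ∀ v → Dec (P v)) where

      Crossing : Edge Γ → Set₁
      Crossing e = E e × Σ[ x ∈ Vertex Γ ] Σ[ y ∈ Vertex Γ ] (Lift (lsuc lzero) (Connects e x y × P x × ¬ P y))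

      exit : ∀ {u z} (w : Walk E u z) → P u → ¬ P z → Σ[ e ∈ Edge Γ ] (e ∈ edges E w × Crossing e)
      exit [] pu npz = ⊥-elim (npz pu)
      exit {u} (_∷_ {v = v} (e , Ee , c) w) pu npz with P? v
      ... | no npv = e , here refl , Ee , u , v , lift (c , pu , npv)
      ... | yes pv with exit w pv npz
      ... | e' , e'∈ , cr = e' , there e'∈ , cr

      entry : ∀ {u z} (w : Walk E u z) → ¬ P u → P z → Σ[ e ∈ Edge Γ ] (e ∈ edges E w × Crossing e)
      entry [] npu pz = ⊥-elim (npu pz)
      entry {u} (_∷_ {v = v} (e , Ee , c) w) npu pz with P? v
      ... | yes pv = e , here refl , Ee , v , u , lift (Connects-sym {e = e} c , pv , npu)
      ... | no npv with entry w npv pz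
      ... | e' , e'∈ , cr = e' , there e'∈ , cr

      two-crossings : (C : Cycle E) → ∀ {a b} → a ∈ verts E (Cycle.walk C) → P a → b ∈ verts E (Cycle.walk C) → ¬ P b →
                 Σ[ e ∈ Edge Γ ] Σ[ e' ∈ Edge Γ ] (e ∈ edges E (Cycle.walk C) × e' ∈ edges E (Cycle.walk C) × e ≢ e' × Crossing e × Crossing e')
      two-crossings C {a} {b} a∈ pa b∈ npb with P? (Cycle.start C)
      ... | yes ps with splitAt (Cycle.walk C) b∈
      ... | w1 , w2 , eq with exit w1 ps npb | entry w2 npb ps
      ... | e1 , e1∈ , c1 | e2 , e2∈ , c2 =
            e1 , e2 , subst (e1 ∈_) (sym eq) (∈-++⁺ˡ e1∈) , subst (e2 ∈_) (sym eq) (∈-++⁺ʳ (edges E w1) e2∈)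
            , Unique-++⇒disjoint (edges E w1) (subst Unique eq (Cycle.uniqE C)) e1∈ e2∈ , c1 , c2
      two-crossings C {a} {b} a∈ pa b∈ npb | no nps with splitAt (Cycle.walk C) a∈
      ... | w1 , w2 , eq with entry w1 nps pa | exit w2 pa nps
      ... | e1 , e1∈ , c1 | e2 , e2∈ , c2 =
            e1 , e2 , subst (e1 ∈_) (sym eq) (∈-++⁺ˡ e1∈) , subst (e2 ∈_) (sym eq) (∈-++⁺ʳ (edges E w1) e2∈)
            , Unique-++⇒disjoint (edges E w1) (subst Unique eq (Cycle.uniqE C)) e1∈ e2∈ , c1 , c2

    some-edge : (C : Cycle E) → Σ[ e ∈ Edge Γ ] Σ[ x ∈ Vertex Γ ] Σ[ y ∈ Vertex Γ ]
                (e ∈ edges E (Cycle.walk C) × E e × Lift (lsuc lzero) (Connects e x y))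
    some-edge C with Cycle.walk C | Cycle.nonempty C
    ... | (e , Ee , c) ∷ w | _ = e , _ , _ , here refl , Ee , lift c

    start∈ : (C : Cycle E) → Cycle.start C ∈ verts E (Cycle.walk C)
    start∈ C with Cycle.walk C | Cycle.nonempty C
    ... | _ ∷ _ | _ = here refl

    Loopless : Set₁
    Loopless = ∀ e x y → E e → Connects e x y → x ≢ y

    ¬single-vertex : Loopless → (C : Cycle E) → ∀ x → ¬ (∀ v → v ∈ verts E (Cycle.walk C) → v ≡ x)
    ¬single-vertex loopless C x all with some-edge C
    ... | e0 , x0 , y0 , e0∈ , Ee0 , lift c0 with cycle-edge-endpoints∈ (Cycle.walk C) (Cycle.nonempty C) e0∈ c0
    ... | x0∈ , y0∈ = loopless e0 x0 y0 Ee0 c0 (trans (all x0 x0∈) (sym (all y0 y0∈)))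

    IncidentAt : Cycle E → Edge Γ → Vertex Γ → Set₁
    IncidentAt C e v = E e × Σ[ y ∈ Vertex Γ ] Lift (lsuc lzero) (Connects e v y × y ∈ verts E (Cycle.walk C) × y ≢ v)

    TwoIncidentEdges : Cycle E → Vertex Γ → Set₁
    TwoIncidentEdges C v = Σ[ e ∈ Edge Γ ] Σ[ e' ∈ Edge Γ ]
      (e ∈ edges E (Cycle.walk C) × e' ∈ edges E (Cycle.walk C) × e ≢ e' × IncidentAt C e v × IncidentAt C e' v)

    -- The cycle passes through some vertex b ≢ v, so it leaves v and comes back to it.
    two-incident-edges : DecidableEquality (Vertex Γ) → Loopless →
                         (C : Cycle E) → ∀ {v} → v ∈ verts E (Cycle.walk C) → TwoIncidentEdges C v
    two-incident-edges eq? loopless C {v} v∈ with some-edge C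
    ... | e0 , x0 , y0 , e0∈ , Ee0 , lift c0 with cycle-edge-endpoints∈ (Cycle.walk C) (Cycle.nonempty C) e0∈ c0
    ... | x0∈ , y0∈ = incident (another-vertex (eq? x0 v))
      where
        another-vertex : Dec (x0 ≡ v) → Σ[ b ∈ Vertex Γ ] (b ∈ verts E (Cycle.walk C) × b ≢ v)
        another-vertex (no x0≢v) = x0 , x0∈ , x0≢v
        another-vertex (yes refl) = y0 , y0∈ , λ eq → loopless e0 x0 y0 Ee0 c0 (sym eq)
        endpoint∈ : ∀ {e x y} → e ∈ edges E (Cycle.walk C) → Connects e x y → y ∈ verts E (Cycle.walk C)
        endpoint∈ e∈ c = proj₂ (cycle-edge-endpoints∈ (Cycle.walk C) (Cycle.nonempty C) e∈ c)
        incident : Σ[ b ∈ Vertex Γ ] (b ∈ verts E (Cycle.walk C) × b ≢ v) → TwoIncidentEdges C v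
        incident (b , b∈ , b≢v) with two-crossings (_≡ v) (λ u → eq? u v) C v∈ refl b∈ b≢v
        ... | e , e' , e∈ , e'∈ , e≢e' , (Ee , _ , y , lift (c , refl , y≢v)) , (Ee' , _ , y' , lift (c' , refl , y'≢v)) =
              e , e' , e∈ , e'∈ , e≢e' , (Ee , y , lift (c , endpoint∈ e∈ c , y≢v)) , (Ee' , y' , lift (c' , endpoint∈ e'∈ c' , y'≢v))

-- Additive resolutions

data Mul : Conn → Set where
  mT : Mul tensor
  mP : Mul par

data Add : Conn → Set where
  aW : Add with'
  aP : Add plus

mul⊎add : ∀ k → Mul k ⊎ Add k
mul⊎add tensor = inj₁ mT
mul⊎add par = inj₁ mP
mul⊎add with' = inj₂ aW
mul⊎add plus = inj₂ aP

Add→Additive : ∀ {k} → Add k → Additive k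
Add→Additive aW = inj₁ refl
Add→Additive aP = inj₂ refl

Mul¬Additive : ∀ {k} → Mul k → ¬ Additive k
Mul¬Additive mT (inj₁ ())
Mul¬Additive mT (inj₂ ())
Mul¬Additive mP (inj₁ ())
Mul¬Additive mP (inj₂ ())

-- An additive resolution, as the subtree of surviving vertices (Defs encodes it by a Choice).
data Res : Formula → Set where
  rpos : ∀ {n} → Res (pos n)
  rneg : ∀ {n} → Res (neg n)
  rb : ∀ {k B C} → Mul k → Res B → Res C → Res (bin k B C)
  rl : ∀ {k B C} → Add k → Res B → Res (bin k B C)
  rr : ∀ {k B C} → Add k → Res C → Res (bin k B C)

InR : ∀ {F} → Res F → Pos F → Set
InR r root = ⊤
InR (rb _ r1 r2) (inl q) = InR r1 q
InR (rb _ r1 r2) (inr q) = InR r2 q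
InR (rl _ r1) (inl q) = InR r1 q
InR (rl _ r1) (inr q) = ⊥
InR (rr _ r2) (inl q) = ⊥
InR (rr _ r2) (inr q) = InR r2 q

InR-dec : ∀ {F} (r : Res F) (q : Pos F) → Dec (InR r q)
InR-dec r root = yes tt
InR-dec (rb _ r1 r2) (inl q) = InR-dec r1 q
InR-dec (rb _ r1 r2) (inr q) = InR-dec r2 q
InR-dec (rl _ r1) (inl q) = InR-dec r1 q
InR-dec (rl _ r1) (inr q) = no λ ()
InR-dec (rr _ r2) (inl q) = no λ ()
InR-dec (rr _ r2) (inr q) = InR-dec r2 q

InR-≼-closed : ∀ {F} (r : Res F) {p q : Pos F} → p ≼ q → InR r q → InR r p
InR-≼-closed r ≼root _ = tt
InR-≼-closed (rb _ r1 r2) (≼l a) i = InR-≼-closed r1 a i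
InR-≼-closed (rb _ r1 r2) (≼r a) i = InR-≼-closed r2 a i
InR-≼-closed (rl _ r1) (≼l a) i = InR-≼-closed r1 a i
InR-≼-closed (rr _ r2) (≼r a) i = InR-≼-closed r2 a i

LeafR : ∀ {F} → Res F → Pos F → Set
LeafR r q = InR r q × IsAtom (sub q)

leaf-above : ∀ {F} (r : Res F) (q : Pos F) → InR r q → Σ[ x ∈ Pos F ] (q ≼ x × LeafR r x)
leaf-above (rpos {n}) root _ = root , ≼root , tt , n , inj₁ refl
leaf-above (rneg {n}) root _ = root , ≼root , tt , n , inj₂ refl
leaf-above (rb _ r1 r2) root _ with leaf-above r1 root tt
... | x , _ , l = inl x , ≼root , l
leaf-above (rl _ r1) root _ with leaf-above r1 root tt
... | x , _ , l = inl x , ≼root , l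
leaf-above (rr _ r2) root _ with leaf-above r2 root tt
... | x , _ , l = inr x , ≼root , l
leaf-above (rb _ r1 r2) (inl q) i with leaf-above r1 q i
... | x , a , l = inl x , ≼l a , l
leaf-above (rb _ r1 r2) (inr q) i with leaf-above r2 q i
... | x , a , l = inr x , ≼r a , l
leaf-above (rl _ r1) (inl q) i with leaf-above r1 q i
... | x , a , l = inl x , ≼l a , l
leaf-above (rr _ r2) (inr q) i with leaf-above r2 q i
... | x , a , l = inr x , ≼r a , l

choiceOf : ∀ {F} → Res F → Pos F → Side
choiceOf (rb _ r1 r2) (inl q) = choiceOf r1 q
choiceOf (rb _ r1 r2) (inr q) = choiceOf r2 q
choiceOf (rl _ r1) (inl q) = choiceOf r1 q
choiceOf (rr _ r2) (inr q) = choiceOf r2 q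
choiceOf (rl _ r1) root = L
choiceOf (rr _ r2) root = R
choiceOf _ _ = L

inSel⇒InR : ∀ {F} (r : Res F) (q : Pos F) → inSelPos Additive F (choiceOf r) q → InR r q
inSel⇒InR r root _ = tt
inSel⇒InR (rb _ r1 r2) (inl q) (_ , s) = inSel⇒InR r1 q s
inSel⇒InR (rb _ r1 r2) (inr q) (_ , s) = inSel⇒InR r2 q s
inSel⇒InR (rl _ r1) (inl q) (_ , s) = inSel⇒InR r1 q s
inSel⇒InR (rl a r1) (inr q) (f , s) with f (Add→Additive a)
... | ()
inSel⇒InR (rr a r2) (inl q) (f , s) with f (Add→Additive a)
... | ()
inSel⇒InR (rr _ r2) (inr q) (_ , s) = inSel⇒InR r2 q s

InR⇒inSel : ∀ {F} (r : Res F) (q : Pos F) → InR r q → inSelPos Additive F (choiceOf r) q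
InR⇒inSel r root _ = tt
InR⇒inSel (rb m r1 r2) (inl q) i = (λ a → ⊥-elim (Mul¬Additive m a)) , InR⇒inSel r1 q i
InR⇒inSel (rb m r1 r2) (inr q) i = (λ a → ⊥-elim (Mul¬Additive m a)) , InR⇒inSel r2 q i
InR⇒inSel (rl _ r1) (inl q) i = (λ _ → refl) , InR⇒inSel r1 q i
InR⇒inSel (rr _ r2) (inr q) i = (λ _ → refl) , InR⇒inSel r2 q i

inSel-mono : ∀ {P P' : Conn → Set} → (∀ k → P' k → P k) → ∀ F (c : Pos F → Side) q → inSelPos P F c q → inSelPos P' F c q
inSel-mono h F c root _ = tt
inSel-mono h (bin k A B) c (inl q) (f , s) = (λ p → f (h k p)) , inSel-mono h A _ q s
inSel-mono h (bin k A B) c (inr q) (f , s) = (λ p → f (h k p)) , inSel-mono h B _ q s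

inSel-≼-closed : ∀ {P} F (c : Pos F → Side) {p q} → p ≼ q → inSelPos P F c q → inSelPos P F c p
inSel-≼-closed F c ≼root _ = tt
inSel-≼-closed (bin k A B) c (≼l a) (f , s) = f , inSel-≼-closed A _ a s
inSel-≼-closed (bin k A B) c (≼r a) (f , s) = f , inSel-≼-closed B _ a s

inSel-leaf-above : ∀ F (c : Pos F → Side) q → inSelPos Additive F c q → Σ[ x ∈ Pos F ] (q ≼ x × IsAtom (sub x) × inSelPos Additive F c x)
inSel-leaf-above (pos n) c root _ = root , ≼root , (n , inj₁ refl) , tt
inSel-leaf-above (neg n) c root _ = root , ≼root , (n , inj₂ refl) , tt
inSel-leaf-above (bin k A B) c root _ with c root in eq
... | L with inSel-leaf-above A (λ q → c (inl q)) root tt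
... | x , _ , at , s = inl x , ≼root , at , (λ _ → eq) , s
inSel-leaf-above (bin k A B) c root _ | R with inSel-leaf-above B (λ q → c (inr q)) root tt
... | x , _ , at , s = inr x , ≼root , at , (λ _ → eq) , s
inSel-leaf-above (bin k A B) c (inl q) (f , s) with inSel-leaf-above A _ q s
... | x , a , at , s' = inl x , ≼l a , at , f , s'
inSel-leaf-above (bin k A B) c (inr q) (f , s) with inSel-leaf-above B _ q s
... | x , a , at , s' = inr x , ≼r a , at , f , s'

dualRes : ∀ {F} → Res F → Res (dual F)
dualRes rpos = rneg
dualRes rneg = rpos
dualRes (rb mT r1 r2) = rb mP (dualRes r2) (dualRes r1)
dualRes (rb mP r1 r2) = rb mT (dualRes r2) (dualRes r1)
dualRes (rl aW r1) = rr aP (dualRes r1)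
dualRes (rl aP r1) = rr aW (dualRes r1)
dualRes (rr aW r2) = rl aP (dualRes r2)
dualRes (rr aP r2) = rl aW (dualRes r2)

dualRes⁻ : ∀ {F} (r : Res F) (q : Pos F) → InR (dualRes r) (mirror q) → InR r q
dualRes⁻ r root _ = tt
dualRes⁻ (rb mT r1 r2) (inl q) i = dualRes⁻ r1 q i
dualRes⁻ (rb mT r1 r2) (inr q) i = dualRes⁻ r2 q i
dualRes⁻ (rb mP r1 r2) (inl q) i = dualRes⁻ r1 q i
dualRes⁻ (rb mP r1 r2) (inr q) i = dualRes⁻ r2 q i
dualRes⁻ (rl aW r1) (inl q) i = dualRes⁻ r1 q i
dualRes⁻ (rl aP r1) (inl q) i = dualRes⁻ r1 q i
dualRes⁻ (rr aW r2) (inr q) i = dualRes⁻ r2 q i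
dualRes⁻ (rr aP r2) (inr q) i = dualRes⁻ r2 q i
dualRes⁻ (rl aW r1) (inr q) ()
dualRes⁻ (rl aP r1) (inr q) ()
dualRes⁻ (rr aW r2) (inl q) ()
dualRes⁻ (rr aP r2) (inl q) ()

dualRes⁺ : ∀ {F} (r : Res F) (q : Pos F) → InR r q → InR (dualRes r) (mirror q)
dualRes⁺ {F} r root _ = subst (InR (dualRes r)) (sym (mirror-root {F})) tt
dualRes⁺ (rb mT r1 r2) (inl q) i = dualRes⁺ r1 q i
dualRes⁺ (rb mT r1 r2) (inr q) i = dualRes⁺ r2 q i
dualRes⁺ (rb mP r1 r2) (inl q) i = dualRes⁺ r1 q i
dualRes⁺ (rb mP r1 r2) (inr q) i = dualRes⁺ r2 q i
dualRes⁺ (rl aW r1) (inl q) i = dualRes⁺ r1 q i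
dualRes⁺ (rl aP r1) (inl q) i = dualRes⁺ r1 q i
dualRes⁺ (rr aW r2) (inr q) i = dualRes⁺ r2 q i
dualRes⁺ (rr aP r2) (inr q) i = dualRes⁺ r2 q i

-- Linkings and the identity linkings

module _ {Γ : Sequent} where

  ≈-refl : ∀ {λ₁ : Linking Γ} → λ₁ ≈ λ₁
  ≈-refl u v = (λ x → x) , (λ x → x)

  ≈-sym : ∀ {λ₁ λ₂ : Linking Γ} → λ₁ ≈ λ₂ → λ₂ ≈ λ₁
  ≈-sym e u v = proj₂ (e u v) , proj₁ (e u v)

  ≈-trans : ∀ {λ₁ λ₂ λ₃ : Linking Γ} → λ₁ ≈ λ₂ → λ₂ ≈ λ₃ → λ₁ ≈ λ₃
  ≈-trans e f u v = (λ x → proj₁ (f u v) (proj₁ (e u v) x)) , (λ x → proj₂ (e u v) (proj₂ (f u v) x))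

  LeafOf-≈ : ∀ {λ₁ λ₂ : Linking Γ} → λ₁ ≈ λ₂ → ∀ x → LeafOf λ₁ x → LeafOf λ₂ x
  LeafOf-≈ e x (inj₁ (y , l)) = inj₁ (y , proj₁ (e x y) l)
  LeafOf-≈ e x (inj₂ (y , l)) = inj₂ (y , proj₁ (e y x) l)

  ResolutionOf-≈ : ∀ {λ₁ λ₂ : Linking Γ} c → λ₁ ≈ λ₂ → ResolutionOf λ₁ c → ResolutionOf λ₂ c
  ResolutionOf-≈ c e ro x = (λ h → LeafOf-≈ e x (proj₁ (ro x) h)) , (λ lo → proj₂ (ro x) (LeafOf-≈ (≈-sym e) x lo))

  IsLinking-≈ : ∀ {λ₁ λ₂ : Linking Γ} → IsLinking λ₁ → λ₁ ≈ λ₂ → IsLinking λ₂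
  IsLinking-≈ {λ₁} {λ₂} il e = record
    { links = λ u v l → IsLinking.links il u v (proj₂ (e u v) l)
    ; disjoint₁ = λ u v v' l l' → IsLinking.disjoint₁ il u v v' (proj₂ (e u v) l) (proj₂ (e u v') l')
    ; disjoint₂ = λ u u' v l l' → IsLinking.disjoint₂ il u u' v (proj₂ (e u v) l) (proj₂ (e u' v) l')
    ; resolution = proj₁ (IsLinking.resolution il) , ResolutionOf-≈ _ e (proj₂ (IsLinking.resolution il)) }

-- A vertex of A^⊥, A is given by its conclusion and a position of A (mirrored in A^⊥).
data Concl : Set where
  sD sA : Concl

sA≢sD : sA ≢ sD
sA≢sD ()

Concl-≟ : (s s' : Concl) → Dec (s ≡ s')
Concl-≟ sD sD = yes refl
Concl-≟ sA sA = yes refl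
Concl-≟ sD sA = no λ ()
Concl-≟ sA sD = no λ ()

dual-pos : ∀ {F n} → dual F ≡ pos n → F ≡ neg n
dual-pos {pos m} ()
dual-pos {neg m} refl = refl
dual-pos {bin tensor B C} ()
dual-pos {bin par B C} ()
dual-pos {bin with' B C} ()
dual-pos {bin plus B C} ()

dual-neg : ∀ {F n} → dual F ≡ neg n → F ≡ pos n
dual-neg {pos m} refl = refl
dual-neg {neg m} ()
dual-neg {bin tensor B C} ()
dual-neg {bin par B C} ()
dual-neg {bin with' B C} ()
dual-neg {bin plus B C} ()

dualAtom : ∀ {F} → IsAtom F → IsAtom (dual F)
dualAtom (n , inj₁ refl) = n , inj₂ refl
dualAtom (n , inj₂ refl) = n , inj₁ refl

dualAtom⁻ : ∀ {F} → IsAtom (dual F) → IsAtom F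
dualAtom⁻ (n , inj₁ e) = n , inj₂ (dual-pos e)
dualAtom⁻ (n , inj₂ e) = n , inj₁ (dual-neg e)

module _ {A : Formula} where

  V : Concl → Pos A → Vertex (idSeq A)
  V sD q = vtx fz (mirror q)
  V sA q = vtx (fs fz) q

  vside : Vertex (idSeq A) → Concl
  vside (vtx fz p) = sD
  vside (vtx (fs fz) p) = sA

  vpos : Vertex (idSeq A) → Pos A
  vpos (vtx fz p) = unmirror p
  vpos (vtx (fs fz) p) = p

  V-η : ∀ v → V (vside v) (vpos v) ≡ v
  V-η (vtx fz p) = cong (vtx fz) (mirror-unmirror p)
  V-η (vtx (fs fz) p) = refl

  vpos⇒V : ∀ v (p : Pos A) → vpos v ≡ p → v ≡ V (vside v) p
  vpos⇒V v p e = trans (sym (V-η v)) (cong (V (vside v)) e)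

  vpos-V : ∀ s q → vpos (V s q) ≡ q
  vpos-V sD q = unmirror-mirror q
  vpos-V sA q = refl

  vside-V : ∀ s q → vside (V s q) ≡ s
  vside-V sD q = refl
  vside-V sA q = refl

  V-inj : ∀ {s s' q q'} → V s q ≡ V s' q' → s ≡ s' × q ≡ q'
  V-inj {s} {s'} {q} {q'} e = trans (sym (vside-V s q)) (trans (cong vside e) (vside-V s' q'))
                            , trans (sym (vpos-V s q)) (trans (cong vpos e) (vpos-V s' q'))

  Vertex-≡-dec : (u v : Vertex (idSeq A)) → Dec (u ≡ v)
  Vertex-≡-dec u v with Concl-≟ (vside u) (vside v) | Pos-≡-dec (vpos u) (vpos v)
  ... | yes a | yes b = yes (trans (sym (V-η u)) (trans (cong₂ V a b) (V-η v)))
  ... | no a | _ = no λ e → a (cong vside e)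
  ... | _ | no b = no λ e → b (cong vpos e)

  IsAtom⇒IsLeaf : ∀ s q → IsAtom (sub q) → IsLeaf (V s q)
  IsAtom⇒IsLeaf sA q at = at
  IsAtom⇒IsLeaf sD q at = subst IsAtom (sym (sub-mirror q)) (dualAtom at)

  IsLeaf⇒IsAtom : ∀ s q → IsLeaf (V s q) → IsAtom (sub q)
  IsLeaf⇒IsAtom sA q at = at
  IsLeaf⇒IsAtom sD q at = dualAtom⁻ (subst IsAtom (sub-mirror q) at)

  axiomLink : Pos A → Vertex (idSeq A) × Vertex (idSeq A)
  axiomLink q = orient (q , mirror q)

  axiomLink-cases : ∀ q → IsAtom (sub q) →
            ((Σ[ n ∈ ℕ ] sub q ≡ pos n) × axiomLink q ≡ (V sA q , V sD q)) ⊎ ((Σ[ n ∈ ℕ ] sub q ≡ neg n) × axiomLink q ≡ (V sD q , V sA q))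
  axiomLink-cases q (n , inj₁ e) = inj₁ ((n , e) , helper)
    where helper : axiomLink q ≡ (V sA q , V sD q)
          helper rewrite e = refl
  axiomLink-cases q (n , inj₂ e) = inj₂ ((n , e) , helper)
    where helper : axiomLink q ≡ (V sD q , V sA q)
          helper rewrite e = refl

  idLinking : Res A → Linking (idSeq A)
  idLinking r u v = Σ[ q ∈ Pos A ] (LeafR r q × (u , v) ≡ axiomLink q)

  idLinking-leaf⁺ : ∀ r s q → LeafR r q → LeafOf (idLinking r) (V s q)
  idLinking-leaf⁺ r s q lr with axiomLink-cases q (proj₂ lr)
  idLinking-leaf⁺ r sA q lr | inj₁ (_ , e) = inj₁ (V sD q , q , lr , sym e)
  idLinking-leaf⁺ r sD q lr | inj₁ (_ , e) = inj₂ (V sA q , q , lr , sym e)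
  idLinking-leaf⁺ r sA q lr | inj₂ (_ , e) = inj₂ (V sD q , q , lr , sym e)
  idLinking-leaf⁺ r sD q lr | inj₂ (_ , e) = inj₁ (V sA q , q , lr , sym e)

  idLinking-leaf⁻ : ∀ r v → LeafOf (idLinking r) v → LeafR r (vpos v)
  idLinking-leaf⁻ r v (inj₁ (y , q , lr , eq)) with axiomLink-cases q (proj₂ lr)
  ... | inj₁ (_ , e) = subst (LeafR r) (sym (trans (cong vpos (cong proj₁ (trans eq e))) (vpos-V sA q))) lr
  ... | inj₂ (_ , e) = subst (LeafR r) (sym (trans (cong vpos (cong proj₁ (trans eq e))) (vpos-V sD q))) lr
  idLinking-leaf⁻ r v (inj₂ (y , q , lr , eq)) with axiomLink-cases q (proj₂ lr)
  ... | inj₁ (_ , e) = subst (LeafR r) (sym (trans (cong vpos (cong proj₂ (trans eq e))) (vpos-V sD q))) lr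
  ... | inj₂ (_ , e) = subst (LeafR r) (sym (trans (cong vpos (cong proj₂ (trans eq e))) (vpos-V sA q))) lr

  idLinking-leaf : ∀ r v → LeafR r (vpos v) → LeafOf (idLinking r) v
  idLinking-leaf r v lr = subst (LeafOf (idLinking r)) (V-η v) (idLinking-leaf⁺ r (vside v) (vpos v) lr)

  resChoice : Res A → Choice (idSeq A)
  resChoice r (vtx fz p) = choiceOf (dualRes r) p
  resChoice r (vtx (fs fz) q) = choiceOf r q

  resChoice⁻ : ∀ r v → inRes (resChoice r) v → InR r (vpos v)
  resChoice⁻ r (vtx fz p) s = dualRes⁻ r (unmirror p) (subst (InR (dualRes r)) (sym (mirror-unmirror p)) (inSel⇒InR (dualRes r) p s))
  resChoice⁻ r (vtx (fs fz) q) s = inSel⇒InR r q s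

  resChoice⁺ : ∀ r v → InR r (vpos v) → inRes (resChoice r) v
  resChoice⁺ r (vtx fz p) i = InR⇒inSel (dualRes r) p (subst (InR (dualRes r)) (mirror-unmirror p) (dualRes⁺ r (unmirror p) i))
  resChoice⁺ r (vtx (fs fz) q) i = InR⇒inSel r q i

  IsLeaf⇒atomPos : ∀ v → IsLeaf v → IsAtom (sub (vpos v))
  IsLeaf⇒atomPos v l = IsLeaf⇒IsAtom (vside v) (vpos v) (subst IsLeaf (sym (V-η v)) l)

  atomPos⇒IsLeaf : ∀ v → IsAtom (sub (vpos v)) → IsLeaf v
  atomPos⇒IsLeaf v a = subst IsLeaf (V-η v) (IsAtom⇒IsLeaf (vside v) (vpos v) a)

  idLinking-resolution : ∀ r → ResolutionOf (idLinking r) (resChoice r)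
  idLinking-resolution r x = (λ { (l , i) → idLinking-leaf r x (resChoice⁻ r x i , IsLeaf⇒atomPos x l) })
             , (λ lo → let lr = idLinking-leaf⁻ r x lo in atomPos⇒IsLeaf x (proj₂ lr) , resChoice⁺ r x (proj₁ lr))

  resolution-≈⁻ : ∀ {λ₁} r c → λ₁ ≈ idLinking r → ResolutionOf λ₁ c → ∀ v → inRes c v → InR r (vpos v)
  resolution-≈⁻ r c e ro (vtx fz p) s with inSel-leaf-above (dual A) _ p s
  ... | x , a , at , s' = InR-≼-closed r (unmirror-≼ a) (proj₁ (idLinking-leaf⁻ r (vtx fz x) (LeafOf-≈ e _ (proj₁ (ro (vtx fz x)) (at , s')))))
  resolution-≈⁻ r c e ro (vtx (fs fz) p) s with inSel-leaf-above A _ p s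
  ... | x , a , at , s' = InR-≼-closed r a (proj₁ (idLinking-leaf⁻ r (vtx (fs fz) x) (LeafOf-≈ e _ (proj₁ (ro (vtx (fs fz) x)) (at , s')))))

  inResOf-≈⁻ : ∀ {λ₁} r → λ₁ ≈ idLinking r → ∀ v → inResOf λ₁ v → InR r (vpos v)
  inResOf-≈⁻ r e v (c , ro , i) = resolution-≈⁻ r c e ro v i

  inResOf-≈⁺ : ∀ {λ₁} r → λ₁ ≈ idLinking r → ∀ v → InR r (vpos v) → inResOf λ₁ v
  inResOf-≈⁺ r e v i = resChoice r , ResolutionOf-≈ (resChoice r) (≈-sym e) (idLinking-resolution r) , resChoice⁺ r v i

Sound : ∀ {F} → Res F → IdL F → Set
Sound {F} r l = ∀ x → x ∈ l → Σ[ q ∈ Pos F ] (LeafR r q × x ≡ (q , mirror q))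

Complete : ∀ {F} → Res F → IdL F → Set
Complete {F} r l = ∀ q → LeafR r q → (q , mirror q) ∈ l

Represents : ∀ {F} → Res F → IdL F → Set
Represents r l = Sound r l × Complete r l

pmap⁻ : ∀ {A B C D} (f : Pos A → Pos C) (g : Pos B → Pos D) {l x} → x ∈ pmap f g l →
        Σ[ y ∈ Pos A × Pos B ] (y ∈ l × x ≡ (f (proj₁ y) , g (proj₂ y)))
pmap⁻ f g m = ∈-map⁻ (λ (q , p) → (f q , g p)) m

pmap⁺ : ∀ {A B C D} {f : Pos A → Pos C} {g : Pos B → Pos D} {l y} → y ∈ l → (f (proj₁ y) , g (proj₂ y)) ∈ pmap f g l
pmap⁺ {f = f} {g} m = ∈-map⁺ (λ (q , p) → (f q , g p)) m

∈-concatMap-map⁻ : ∀ {a} {X Y Z : Set a} (h : X → Y → Z) (xs : List X) {ys : List Y} {z} →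
                   z ∈ concatMap (λ x → map (h x) ys) xs → Σ[ x ∈ X ] Σ[ y ∈ Y ] (x ∈ xs × y ∈ ys × z ≡ h x y)
∈-concatMap-map⁻ h xs z∈ with find (∈-concatMap⁻ (λ x → map (h x) _) {xs = xs} z∈)
... | x , x∈ , z∈' with ∈-map⁻ (h x) z∈'
... | y , y∈ , refl = x , y , x∈ , y∈ , refl

∈-concatMap-map⁺ : ∀ {a} {X Y Z : Set a} (h : X → Y → Z) {xs : List X} {ys : List Y} {x y} →
                   x ∈ xs → y ∈ ys → h x y ∈ concatMap (λ x → map (h x) ys) xs
∈-concatMap-map⁺ h {ys = ys} x∈ y∈ = ∈-concatMap⁺ (λ x → map (h x) ys) (lose x∈ (∈-map⁺ (h _) y∈))

Sound-++ : ∀ {F} {r : Res F} {l l'} → Sound r l → Sound r l' → Sound r (l ++ l')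
Sound-++ {l = l} s s' x x∈ with ∈-++⁻ l x∈
... | inj₁ x∈l = s x x∈l
... | inj₂ x∈l' = s' x x∈l'

Sound-pmap : ∀ {F B} {r : Res F} {r₁ : Res B} {l : IdL B}
             (f : Pos B → Pos F) (g : Pos (dual B) → Pos (dual F)) →
             (∀ q → LeafR r₁ q → LeafR r (f q) × g (mirror q) ≡ mirror (f q)) →
             Sound r₁ l → Sound r (pmap f g l)
Sound-pmap f g emb s x x∈ with pmap⁻ f g x∈
... | y , y∈ , refl with s y y∈
... | q , lr , refl = f q , proj₁ (emb q lr) , cong (f q ,_) (proj₂ (emb q lr))

represents-pos : ∀ {n} → Represents (rpos {n}) ((root , root) ∷ [])
represents-pos {n} = (λ { x (here refl) → root , (tt , n , inj₁ refl) , refl }) , (λ { root _ → here refl })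

represents-neg : ∀ {n} → Represents (rneg {n}) ((root , root) ∷ [])
represents-neg {n} = (λ { x (here refl) → root , (tt , n , inj₂ refl) , refl }) , (λ { root _ → here refl })

represents-⊗ : ∀ {B C} {r₁ : Res B} {r₂ : Res C} {l₁ l₂} → Represents r₁ l₁ → Represents r₂ l₂ →
               Represents (rb mT r₁ r₂) (pmap inl inr l₁ ++ pmap inr inl l₂)
represents-⊗ {l₁ = l₁} (s₁ , c₁) (s₂ , c₂) =
  Sound-++ (Sound-pmap {r = rb mT _ _} inl inr (λ _ lr → lr , refl) s₁) (Sound-pmap {r = rb mT _ _} inr inl (λ _ lr → lr , refl) s₂) , complete
  where
    complete : Complete (rb mT _ _) (pmap inl inr l₁ ++ pmap inr inl _)
    complete root (_ , at) = ⊥-elim (bin-¬IsAtom at)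
    complete (inl q) lr = ∈-++⁺ˡ (pmap⁺ (c₁ q lr))
    complete (inr q) lr = ∈-++⁺ʳ (pmap inl inr l₁) (pmap⁺ (c₂ q lr))

represents-⅋ : ∀ {B C} {r₁ : Res B} {r₂ : Res C} {l₁ l₂} → Represents r₁ l₁ → Represents r₂ l₂ →
               Represents (rb mP r₁ r₂) (pmap inl inr l₁ ++ pmap inr inl l₂)
represents-⅋ {l₁ = l₁} (s₁ , c₁) (s₂ , c₂) =
  Sound-++ (Sound-pmap {r = rb mP _ _} inl inr (λ _ lr → lr , refl) s₁) (Sound-pmap {r = rb mP _ _} inr inl (λ _ lr → lr , refl) s₂) , complete
  where
    complete : Complete (rb mP _ _) (pmap inl inr l₁ ++ pmap inr inl _)
    complete root (_ , at) = ⊥-elim (bin-¬IsAtom at)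
    complete (inl q) lr = ∈-++⁺ˡ (pmap⁺ (c₁ q lr))
    complete (inr q) lr = ∈-++⁺ʳ (pmap inl inr l₁) (pmap⁺ (c₂ q lr))

represents-&ˡ : ∀ {B C} {r₁ : Res B} {l₁} → Represents r₁ l₁ → Represents (rl {C = C} aW r₁) (pmap inl inr l₁)
represents-&ˡ (s₁ , c₁) = Sound-pmap {r = rl aW _} inl inr (λ _ lr → lr , refl) s₁ ,
  λ { root (_ , at) → ⊥-elim (bin-¬IsAtom at) ; (inl q) lr → pmap⁺ (c₁ q lr) ; (inr q) (() , _) }

represents-&ʳ : ∀ {B C} {r₂ : Res C} {l₂} → Represents r₂ l₂ → Represents (rr {B = B} aW r₂) (pmap inr inl l₂)
represents-&ʳ (s₂ , c₂) = Sound-pmap {r = rr aW _} inr inl (λ _ lr → lr , refl) s₂ ,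
  λ { root (_ , at) → ⊥-elim (bin-¬IsAtom at) ; (inl q) (() , _) ; (inr q) lr → pmap⁺ (c₂ q lr) }

represents-⊕ˡ : ∀ {B C} {r₁ : Res B} {l₁} → Represents r₁ l₁ → Represents (rl {C = C} aP r₁) (pmap inl inr l₁)
represents-⊕ˡ (s₁ , c₁) = Sound-pmap {r = rl aP _} inl inr (λ _ lr → lr , refl) s₁ ,
  λ { root (_ , at) → ⊥-elim (bin-¬IsAtom at) ; (inl q) lr → pmap⁺ (c₁ q lr) ; (inr q) (() , _) }

represents-⊕ʳ : ∀ {B C} {r₂ : Res C} {l₂} → Represents r₂ l₂ → Represents (rr {B = B} aP r₂) (pmap inr inl l₂)
represents-⊕ʳ (s₂ , c₂) = Sound-pmap {r = rr aP _} inr inl (λ _ lr → lr , refl) s₂ ,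
  λ { root (_ , at) → ⊥-elim (bin-¬IsAtom at) ; (inl q) (() , _) ; (inr q) lr → pmap⁺ (c₂ q lr) }

idLinkings-sound : ∀ F l → l ∈ idLinkings F → Σ[ r ∈ Res F ] Represents r l
idLinkings-sound (pos n) _ (here refl) = rpos , represents-pos
idLinkings-sound (neg n) _ (here refl) = rneg , represents-neg
idLinkings-sound (bin tensor B C) l l∈ with ∈-concatMap-map⁻ (λ l₁ l₂ → pmap inl inr l₁ ++ pmap inr inl l₂) (idLinkings B) l∈
... | l₁ , l₂ , l₁∈ , l₂∈ , refl with idLinkings-sound B l₁ l₁∈ | idLinkings-sound C l₂ l₂∈
... | r₁ , p₁ | r₂ , p₂ = rb mT r₁ r₂ , represents-⊗ p₁ p₂
idLinkings-sound (bin par B C) l l∈ with ∈-concatMap-map⁻ (λ l₁ l₂ → pmap inl inr l₁ ++ pmap inr inl l₂) (idLinkings B) l∈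
... | l₁ , l₂ , l₁∈ , l₂∈ , refl with idLinkings-sound B l₁ l₁∈ | idLinkings-sound C l₂ l₂∈
... | r₁ , p₁ | r₂ , p₂ = rb mP r₁ r₂ , represents-⅋ p₁ p₂
idLinkings-sound (bin with' B C) l l∈ with ∈-++⁻ (map (pmap inl inr) (idLinkings B)) l∈
... | inj₁ l∈ˡ with ∈-map⁻ (pmap inl inr) l∈ˡ
...   | l₁ , l₁∈ , refl = let (r₁ , p₁) = idLinkings-sound B l₁ l₁∈ in rl aW r₁ , represents-&ˡ p₁
idLinkings-sound (bin with' B C) l l∈ | inj₂ l∈ʳ with ∈-map⁻ (pmap inr inl) l∈ʳ
...   | l₂ , l₂∈ , refl = let (r₂ , p₂) = idLinkings-sound C l₂ l₂∈ in rr aW r₂ , represents-&ʳ p₂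
idLinkings-sound (bin plus B C) l l∈ with ∈-++⁻ (map (pmap inl inr) (idLinkings B)) l∈
... | inj₁ l∈ˡ with ∈-map⁻ (pmap inl inr) l∈ˡ
...   | l₁ , l₁∈ , refl = let (r₁ , p₁) = idLinkings-sound B l₁ l₁∈ in rl aP r₁ , represents-⊕ˡ p₁
idLinkings-sound (bin plus B C) l l∈ | inj₂ l∈ʳ with ∈-map⁻ (pmap inr inl) l∈ʳ
...   | l₂ , l₂∈ , refl = let (r₂ , p₂) = idLinkings-sound C l₂ l₂∈ in rr aP r₂ , represents-⊕ʳ p₂

idLinkings-complete : ∀ F (r : Res F) → Σ[ l ∈ IdL F ] (l ∈ idLinkings F × Represents r l)
idLinkings-complete (pos n) rpos = _ , here refl , represents-pos
idLinkings-complete (neg n) rneg = _ , here refl , represents-neg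
idLinkings-complete (bin tensor B C) (rb mT r₁ r₂) with idLinkings-complete B r₁ | idLinkings-complete C r₂
... | _ , l₁∈ , p₁ | _ , l₂∈ , p₂ =
  _ , ∈-concatMap-map⁺ (λ l₁ l₂ → pmap inl inr l₁ ++ pmap inr inl l₂) l₁∈ l₂∈ , represents-⊗ p₁ p₂
idLinkings-complete (bin par B C) (rb mP r₁ r₂) with idLinkings-complete B r₁ | idLinkings-complete C r₂
... | _ , l₁∈ , p₁ | _ , l₂∈ , p₂ =
  _ , ∈-concatMap-map⁺ (λ l₁ l₂ → pmap inl inr l₁ ++ pmap inr inl l₂) l₁∈ l₂∈ , represents-⅋ p₁ p₂
idLinkings-complete (bin with' B C) (rl aW r₁) with idLinkings-complete B r₁
... | _ , l₁∈ , p₁ = _ , ∈-++⁺ˡ (∈-map⁺ (pmap inl inr) l₁∈) , represents-&ˡ p₁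
idLinkings-complete (bin with' B C) (rr aW r₂) with idLinkings-complete C r₂
... | _ , l₂∈ , p₂ = _ , ∈-++⁺ʳ (map (pmap inl inr) (idLinkings B)) (∈-map⁺ (pmap inr inl) l₂∈) , represents-&ʳ p₂
idLinkings-complete (bin plus B C) (rl aP r₁) with idLinkings-complete B r₁
... | _ , l₁∈ , p₁ = _ , ∈-++⁺ˡ (∈-map⁺ (pmap inl inr) l₁∈) , represents-⊕ˡ p₁
idLinkings-complete (bin plus B C) (rr aP r₂) with idLinkings-complete C r₂
... | _ , l₂∈ , p₂ = _ , ∈-++⁺ʳ (map (pmap inl inr) (idLinkings B)) (∈-map⁺ (pmap inr inl) l₂∈) , represents-⊕ʳ p₂

module _ {A : Formula} where

  toLinking-≈ : ∀ (r : Res A) l → Represents r l → toLinking l ≈ idLinking r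
  toLinking-≈ r l (a , b) u v = to , from
    where
      to : toLinking l u v → idLinking r u v
      to m with ∈-map⁻ orient m
      ... | x , x∈ , eq with a x x∈
      ... | q , lr , refl = q , lr , eq
      from : idLinking r u v → toLinking l u v
      from (q , lr , eq) = subst (_∈ map orient l) (sym eq) (∈-map⁺ orient (b q lr))

  IdNet⇒idLinking : ∀ λ₁ → IdNet A λ₁ → Σ[ r ∈ Res A ] (λ₁ ≈ idLinking r)
  IdNet⇒idLinking λ₁ (lift an) with find an
  ... | l , l∈ , e with idLinkings-sound A l l∈
  ... | r , pc = r , ≈-trans e (toLinking-≈ r l pc)

  idLinking⇒IdNet : ∀ λ₁ (r : Res A) → λ₁ ≈ idLinking r → IdNet A λ₁
  idLinking⇒IdNet λ₁ r e with idLinkings-complete A r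
  ... | l , l∈ , pc = lift (lose l∈ (≈-trans e (≈-sym (toLinking-≈ r l pc))))

select : ∀ {k B C} → Add k → Side → Res B → Res C → Res (bin k B C)
select a L x y = rl a x
select a R x y = rr a y

-- The ⊕-choices of A are the &-choices of A^⊥, read off f⊥ at the mirrored vertex.
resOfChoices : ∀ F → (Pos F → Side) → (Pos (dual F) → Side) → Res F
resOfChoices (pos n) fa f⊥ = rpos
resOfChoices (neg n) fa f⊥ = rneg
resOfChoices (bin tensor B C) fa f⊥ = rb mT
    (resOfChoices B (λ q → fa (inl q)) (λ q → f⊥ (inr q)))
    (resOfChoices C (λ q → fa (inr q)) (λ q → f⊥ (inl q)))
resOfChoices (bin par B C) fa f⊥ = rb mP
    (resOfChoices B (λ q → fa (inl q)) (λ q → f⊥ (inr q)))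
    (resOfChoices C (λ q → fa (inr q)) (λ q → f⊥ (inl q)))
resOfChoices (bin with' B C) fa f⊥ = select aW (fa root)
    (resOfChoices B (λ q → fa (inl q)) (λ q → f⊥ (inr q)))
    (resOfChoices C (λ q → fa (inr q)) (λ q → f⊥ (inl q)))
resOfChoices (bin plus B C) fa f⊥ = select aP (flipSide (f⊥ root))
    (resOfChoices B (λ q → fa (inl q)) (λ q → f⊥ (inr q)))
    (resOfChoices C (λ q → fa (inr q)) (λ q → f⊥ (inl q)))

resOfChoices-inW : ∀ F fa f⊥ q → InR (resOfChoices F fa f⊥) q → inSelPos WithC F fa q
resOfChoices-inW F fa f⊥ root _ = tt
resOfChoices-inW (bin tensor B C) fa f⊥ (inl q) i = (λ ()) , resOfChoices-inW B _ _ q i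
resOfChoices-inW (bin tensor B C) fa f⊥ (inr q) i = (λ ()) , resOfChoices-inW C _ _ q i
resOfChoices-inW (bin par B C) fa f⊥ (inl q) i = (λ ()) , resOfChoices-inW B _ _ q i
resOfChoices-inW (bin par B C) fa f⊥ (inr q) i = (λ ()) , resOfChoices-inW C _ _ q i
resOfChoices-inW (bin plus B C) fa f⊥ (inl q) i with f⊥ root
... | L = ⊥-elim i
... | R = (λ ()) , resOfChoices-inW B _ _ q i
resOfChoices-inW (bin plus B C) fa f⊥ (inr q) i with f⊥ root
... | L = (λ ()) , resOfChoices-inW C _ _ q i
... | R = ⊥-elim i
resOfChoices-inW (bin with' B C) fa f⊥ (inl q) i with fa root
... | L = (λ _ → refl) , resOfChoices-inW B _ _ q i
... | R = ⊥-elim i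
resOfChoices-inW (bin with' B C) fa f⊥ (inr q) i with fa root
... | L = ⊥-elim i
... | R = (λ _ → refl) , resOfChoices-inW C _ _ q i

resOfChoices-inW-dual : ∀ F fa f⊥ q → InR (resOfChoices F fa f⊥) q → inSelPos WithC (dual F) f⊥ (mirror q)
resOfChoices-inW-dual (pos n) fa f⊥ root _ = tt
resOfChoices-inW-dual (neg n) fa f⊥ root _ = tt
resOfChoices-inW-dual (bin k B C) fa f⊥ root _ = tt
resOfChoices-inW-dual (bin tensor B C) fa f⊥ (inl q) i = (λ ()) , resOfChoices-inW-dual B _ _ q i
resOfChoices-inW-dual (bin tensor B C) fa f⊥ (inr q) i = (λ ()) , resOfChoices-inW-dual C _ _ q i
resOfChoices-inW-dual (bin par B C) fa f⊥ (inl q) i = (λ ()) , resOfChoices-inW-dual B _ _ q i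
resOfChoices-inW-dual (bin par B C) fa f⊥ (inr q) i = (λ ()) , resOfChoices-inW-dual C _ _ q i
resOfChoices-inW-dual (bin with' B C) fa f⊥ (inl q) i with fa root
... | L = (λ ()) , resOfChoices-inW-dual B _ _ q i
... | R = ⊥-elim i
resOfChoices-inW-dual (bin with' B C) fa f⊥ (inr q) i with fa root
... | L = ⊥-elim i
... | R = (λ ()) , resOfChoices-inW-dual C _ _ q i
resOfChoices-inW-dual (bin plus B C) fa f⊥ (inl q) i with f⊥ root
... | L = ⊥-elim i
... | R = (λ _ → refl) , resOfChoices-inW-dual B _ _ q i
resOfChoices-inW-dual (bin plus B C) fa f⊥ (inr q) i with f⊥ root
... | L = (λ _ → refl) , resOfChoices-inW-dual C _ _ q i
... | R = ⊥-elim i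

resOfChoices-unique : ∀ F (r : Res F) fa f⊥ →
                      (∀ q → LeafR r q → inSelPos WithC F fa q × inSelPos WithC (dual F) f⊥ (mirror q)) → r ≡ resOfChoices F fa f⊥
resOfChoices-unique (pos n) rpos fa f⊥ h = refl
resOfChoices-unique (neg n) rneg fa f⊥ h = refl
resOfChoices-unique (bin tensor B C) (rb mT r1 r2) fa f⊥ h =
  cong₂ (rb mT) (resOfChoices-unique B r1 _ _ (λ q lr → ×-map proj₂ proj₂ (h (inl q) lr)))
                (resOfChoices-unique C r2 _ _ (λ q lr → ×-map proj₂ proj₂ (h (inr q) lr)))
resOfChoices-unique (bin par B C) (rb mP r1 r2) fa f⊥ h =
  cong₂ (rb mP) (resOfChoices-unique B r1 _ _ (λ q lr → ×-map proj₂ proj₂ (h (inl q) lr)))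
                (resOfChoices-unique C r2 _ _ (λ q lr → ×-map proj₂ proj₂ (h (inr q) lr)))
resOfChoices-unique (bin with' B C) (rl aW r1) fa f⊥ h with leaf-above r1 root tt
... | x , _ , lx with proj₁ (proj₁ (h (inl x) lx)) refl
... | eq rewrite eq = cong (rl aW) (resOfChoices-unique B r1 _ _ (λ q lr → ×-map proj₂ proj₂ (h (inl q) lr)))
resOfChoices-unique (bin with' B C) (rr aW r2) fa f⊥ h with leaf-above r2 root tt
... | x , _ , lx with proj₁ (proj₁ (h (inr x) lx)) refl
... | eq rewrite eq = cong (rr aW) (resOfChoices-unique C r2 _ _ (λ q lr → ×-map proj₂ proj₂ (h (inr q) lr)))
resOfChoices-unique (bin plus B C) (rl aP r1) fa f⊥ h with leaf-above r1 root tt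
... | x , _ , lx with proj₁ (proj₂ (h (inl x) lx)) refl
... | eq rewrite eq = cong (rl aP) (resOfChoices-unique B r1 _ _ (λ q lr → ×-map proj₂ proj₂ (h (inl q) lr)))
resOfChoices-unique (bin plus B C) (rr aP r2) fa f⊥ h with leaf-above r2 root tt
... | x , _ , lx with proj₁ (proj₂ (h (inr x) lx)) refl
... | eq rewrite eq = cong (rr aP) (resOfChoices-unique C r2 _ _ (λ q lr → ×-map proj₂ proj₂ (h (inr q) lr)))

module _ {A : Formula} where

  axiomLink-vpos : ∀ q → IsAtom (sub q) → vpos {A} (proj₁ (axiomLink q)) ≡ q × vpos {A} (proj₂ (axiomLink q)) ≡ q
  axiomLink-vpos q at with axiomLink-cases q at
  ... | inj₁ (_ , e) rewrite e = vpos-V sA q , vpos-V sD q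
  ... | inj₂ (_ , e) rewrite e = vpos-V sD q , vpos-V sA q

  idLinking-vpos : ∀ (r : Res A) {u v} → ((q , _ , _) : idLinking r u v) → vpos u ≡ q × vpos v ≡ q
  idLinking-vpos r (q , (_ , at) , refl) = axiomLink-vpos q at

  idLinking-labels : ∀ (r : Res A) u v → idLinking r u v → Σ[ n ∈ ℕ ] (label u ≡ pos n × label v ≡ neg n)
  idLinking-labels r u v (q , (i , at) , eq) with axiomLink-cases q at
  ... | inj₁ ((n , e) , le) with trans eq le
  ... | refl = n , e , trans (sub-mirror q) (cong dual e)
  idLinking-labels r u v (q , (i , at) , eq) | inj₂ ((n , e) , le) with trans eq le
  ... | refl = n , trans (sub-mirror q) (cong dual e) , e

  idLinking-functional : ∀ (r : Res A) {u v u' v'} → idLinking r u v → idLinking r u' v' → u ≡ u' ⊎ v ≡ v' → (u , v) ≡ (u' , v')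
  idLinking-functional r {u} {v} {u'} {v'} l@(q , _ , eq) l'@(q' , _ , eq') h = trans eq (trans (cong axiomLink (same h)) (sym eq'))
    where
      same : u ≡ u' ⊎ v ≡ v' → q ≡ q'
      same (inj₁ refl) = trans (sym (proj₁ (idLinking-vpos r l))) (proj₁ (idLinking-vpos r l'))
      same (inj₂ refl) = trans (sym (proj₂ (idLinking-vpos r l))) (proj₂ (idLinking-vpos r l'))

  idLinking-IsLinking : ∀ (r : Res A) → IsLinking (idLinking r)
  idLinking-IsLinking r = record
    { links = idLinking-labels r
    ; disjoint₁ = λ u v v' l l' → cong proj₂ (idLinking-functional r l l' (inj₁ refl))
    ; disjoint₂ = λ u u' v l l' → cong proj₁ (idLinking-functional r l l' (inj₂ refl))
    ; resolution = resChoice r , idLinking-resolution r }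

  IdNet⇒IsLinking : ∀ λ₁ → IdNet A λ₁ → IsLinking λ₁
  IdNet⇒IsLinking λ₁ h with IdNet⇒idLinking λ₁ h
  ... | r , e = IsLinking-≈ (idLinking-IsLinking r) (≈-sym e)

  module _ (c : Choice (idSeq A)) where
    choiceA : Pos A → Side
    choiceA q = c (vtx (fs fz) q)
    choiceA⊥ : Pos (dual A) → Side
    choiceA⊥ p = c (vtx fz p)
    resOn : Res A
    resOn = resOfChoices A choiceA choiceA⊥

    resOn-OnWRes : OnWRes (idLinking resOn) c
    resOn-OnWRes (vtx fz p) lo = subst (inSelPos WithC (dual A) choiceA⊥) (mirror-unmirror p)
      (resOfChoices-inW-dual A choiceA choiceA⊥ (unmirror p) (proj₁ (idLinking-leaf⁻ resOn (vtx fz p) lo)))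
    resOn-OnWRes (vtx (fs fz) q) lo = resOfChoices-inW A choiceA choiceA⊥ q (proj₁ (idLinking-leaf⁻ resOn (vtx (fs fz) q) lo))

    OnWRes⇒≡resOn : ∀ (r : Res A) λ₂ → λ₂ ≈ idLinking r → OnWRes λ₂ c → r ≡ resOn
    OnWRes⇒≡resOn r λ₂ e ow = resOfChoices-unique A r choiceA choiceA⊥
      (λ q lr → ow (V sA q) (LeafOf-≈ (≈-sym e) _ (idLinking-leaf⁺ r sA q lr)) , ow (V sD q) (LeafOf-≈ (≈-sym e) _ (idLinking-leaf⁺ r sD q lr)))

  identity-P1 : ∀ (c : Choice (idSeq A)) → Σ[ λ₁ ∈ Linking (idSeq A) ]
           (IdNet A λ₁ × OnWRes λ₁ c × (∀ λ₂ → IdNet A λ₂ → OnWRes λ₂ c → λ₂ ≈ λ₁))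
  identity-P1 c = idLinking (resOn c) , idLinking⇒IdNet _ (resOn c) ≈-refl , resOn-OnWRes c , uniq
    where
      uniq : ∀ λ₂ → IdNet A λ₂ → OnWRes λ₂ c → λ₂ ≈ idLinking (resOn c)
      uniq λ₂ h ow with IdNet⇒idLinking λ₂ h
      ... | r , e = subst (λ r' → λ₂ ≈ idLinking r') (OnWRes⇒≡resOn c r λ₂ e ow) e

-- Uniqueness for a non-ambiguous formula

AtomOf : ℕ → Formula → Set
AtomOf n F = F ≡ pos n ⊎ F ≡ neg n

occ-self : ∀ n → 1 ≤ (if ⌊ n ≟ n ⌋ then 1 else 0)
occ-self n with n ≟ n
... | yes _ = s≤s z≤n
... | no n≢n = ⊥-elim (n≢n refl)

occ≥1 : ∀ {A} (q : Pos A) n → AtomOf n (sub q) → 1 ≤ occ n A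
occ≥1 {pos m} root n (inj₁ refl) = occ-self n
occ≥1 {neg m} root n (inj₂ refl) = occ-self n
occ≥1 {bin k B C} root n (inj₁ ())
occ≥1 {bin k B C} root n (inj₂ ())
occ≥1 {bin k B C} (inl q) n a = ≤-trans (occ≥1 q n a) (m≤m+n _ _)
occ≥1 {bin k B C} (inr q) n a = ≤-trans (occ≥1 q n a) (m≤n+m _ _)

occ≥2 : ∀ {A} (q q' : Pos A) n → AtomOf n (sub q) → AtomOf n (sub q') → q ≢ q' → 2 ≤ occ n A
occ≥2 {pos m} root root n a a' ne = ⊥-elim (ne refl)
occ≥2 {neg m} root root n a a' ne = ⊥-elim (ne refl)
occ≥2 {bin k B C} root q' n (inj₁ ()) a'
occ≥2 {bin k B C} root q' n (inj₂ ()) a'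
occ≥2 {bin k B C} (inl q) root n a (inj₁ ())
occ≥2 {bin k B C} (inl q) root n a (inj₂ ())
occ≥2 {bin k B C} (inr q) root n a (inj₁ ())
occ≥2 {bin k B C} (inr q) root n a (inj₂ ())
occ≥2 {bin k B C} (inl q) (inl q') n a a' ne = ≤-trans (occ≥2 q q' n a a' (λ e → ne (cong inl e))) (m≤m+n _ _)
occ≥2 {bin k B C} (inr q) (inr q') n a a' ne = ≤-trans (occ≥2 q q' n a a' (λ e → ne (cong inr e))) (m≤n+m _ _)
occ≥2 {bin k B C} (inl q) (inr q') n a a' ne = +-mono-≤ (occ≥1 q n a) (occ≥1 q' n a')
occ≥2 {bin k B C} (inr q) (inl q') n a a' ne = subst (2 ≤_) (+-comm (occ n C) (occ n B)) (+-mono-≤ (occ≥1 q n a) (occ≥1 q' n a'))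

NonAmbiguous⇒atom-unique : ∀ {A} → NonAmbiguous A → ∀ {n} (q q' : Pos A) → AtomOf n (sub q) → AtomOf n (sub q') → q ≡ q'
NonAmbiguous⇒atom-unique na q q' a a' with Pos-≡-dec q q'
... | yes e = e
... | no ne with ≤-trans (occ≥2 q q' _ a a' ne) (na _)
... | s≤s ()

resOfAdditive : ∀ F → (Pos F → Side) → Res F
resOfAdditive (pos n) f = rpos
resOfAdditive (neg n) f = rneg
resOfAdditive (bin tensor B C) f = rb mT (resOfAdditive B (λ q → f (inl q))) (resOfAdditive C (λ q → f (inr q)))
resOfAdditive (bin par B C) f = rb mP (resOfAdditive B (λ q → f (inl q))) (resOfAdditive C (λ q → f (inr q)))
resOfAdditive (bin with' B C) f = select aW (f root) (resOfAdditive B (λ q → f (inl q))) (resOfAdditive C (λ q → f (inr q)))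
resOfAdditive (bin plus B C) f = select aP (f root) (resOfAdditive B (λ q → f (inl q))) (resOfAdditive C (λ q → f (inr q)))

resOfAdditive⁺ : ∀ F f q → inSelPos Additive F f q → InR (resOfAdditive F f) q
resOfAdditive⁺ F f root _ = tt
resOfAdditive⁺ (bin tensor B C) f (inl q) (_ , s) = resOfAdditive⁺ B _ q s
resOfAdditive⁺ (bin tensor B C) f (inr q) (_ , s) = resOfAdditive⁺ C _ q s
resOfAdditive⁺ (bin par B C) f (inl q) (_ , s) = resOfAdditive⁺ B _ q s
resOfAdditive⁺ (bin par B C) f (inr q) (_ , s) = resOfAdditive⁺ C _ q s
resOfAdditive⁺ (bin with' B C) f (inl q) (h , s) with f root | h (inj₁ refl)
... | L | _ = resOfAdditive⁺ B _ q s
resOfAdditive⁺ (bin with' B C) f (inr q) (h , s) with f root | h (inj₁ refl)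
... | R | _ = resOfAdditive⁺ C _ q s
resOfAdditive⁺ (bin plus B C) f (inl q) (h , s) with f root | h (inj₂ refl)
... | L | _ = resOfAdditive⁺ B _ q s
resOfAdditive⁺ (bin plus B C) f (inr q) (h , s) with f root | h (inj₂ refl)
... | R | _ = resOfAdditive⁺ C _ q s

resOfAdditive⁻ : ∀ F f q → InR (resOfAdditive F f) q → inSelPos Additive F f q
resOfAdditive⁻ F f root _ = tt
resOfAdditive⁻ (bin tensor B C) f (inl q) i = (λ { (inj₁ ()) ; (inj₂ ()) }) , resOfAdditive⁻ B _ q i
resOfAdditive⁻ (bin tensor B C) f (inr q) i = (λ { (inj₁ ()) ; (inj₂ ()) }) , resOfAdditive⁻ C _ q i
resOfAdditive⁻ (bin par B C) f (inl q) i = (λ { (inj₁ ()) ; (inj₂ ()) }) , resOfAdditive⁻ B _ q i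
resOfAdditive⁻ (bin par B C) f (inr q) i = (λ { (inj₁ ()) ; (inj₂ ()) }) , resOfAdditive⁻ C _ q i
resOfAdditive⁻ (bin with' B C) f (inl q) i with f root
... | L = (λ _ → refl) , resOfAdditive⁻ B _ q i
... | R = ⊥-elim i
resOfAdditive⁻ (bin with' B C) f (inr q) i with f root
... | L = ⊥-elim i
... | R = (λ _ → refl) , resOfAdditive⁻ C _ q i
resOfAdditive⁻ (bin plus B C) f (inl q) i with f root
... | L = (λ _ → refl) , resOfAdditive⁻ B _ q i
... | R = ⊥-elim i
resOfAdditive⁻ (bin plus B C) f (inr q) i with f root
... | L = ⊥-elim i
... | R = (λ _ → refl) , resOfAdditive⁻ C _ q i

pos≢neg : ∀ {F n m} → F ≡ pos n → F ≡ neg m → ⊥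
pos≢neg refl ()

module _ {A : Formula} where

  idLinking-at : ∀ (r : Res A) {a b} σ q → idLinking r a b → a ≡ V σ q ⊎ b ≡ V σ q → (a , b) ≡ axiomLink q
  idLinking-at r {a} {b} σ q l@(q' , _ , eq) h = trans eq (cong axiomLink (same h))
    where
      same : a ≡ V σ q ⊎ b ≡ V σ q → q' ≡ q
      same (inj₁ refl) = trans (sym (proj₁ (idLinking-vpos r l))) (vpos-V σ q)
      same (inj₂ refl) = trans (sym (proj₂ (idLinking-vpos r l))) (vpos-V σ q)

  idLinking-OnWRes : ∀ (r : Res A) → OnWRes (idLinking r) (resChoice r)
  idLinking-OnWRes r x lo =
    inSel-mono (λ k w → inj₁ w) (lookup (idSeq A) (Vertex.index x)) _ (Vertex.position x) (proj₂ (proj₂ (idLinking-resolution r x) lo))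

module _ {A : Formula} (na : NonAmbiguous A) where

  labelAtomOf : ∀ s (q : Pos A) n → (label (V s q) ≡ pos n ⊎ label (V s q) ≡ neg n) → AtomOf n (sub q)
  labelAtomOf sA q n h = h
  labelAtomOf sD q n (inj₁ e) = inj₂ (dual-pos (trans (sym (sub-mirror q)) e))
  labelAtomOf sD q n (inj₂ e) = inj₁ (dual-neg (trans (sym (sub-mirror q)) e))

  module Forced (λ₁ : Linking (idSeq A)) (il : IsLinking λ₁) where
    c : Choice (idSeq A)
    c = proj₁ (IsLinking.resolution il)

    ro : ResolutionOf λ₁ c
    ro = proj₂ (IsLinking.resolution il)

    r : Res A
    r = resOfAdditive A (λ q → c (vtx (fs fz) q))

    leaf-InR : ∀ q → LeafOf λ₁ (V sA q) → InR r q
    leaf-InR q lo = resOfAdditive⁺ A _ q (proj₂ (proj₂ (ro (V sA q)) lo))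

    -- Non-ambiguity puts both ends of a link at the same position of A, hence in opposite conclusions.
    λ⊆idLinking′ : ∀ su q sv q' → λ₁ (V su q) (V sv q') → idLinking r (V su q) (V sv q')
    λ⊆idLinking′ su q sv q' l with IsLinking.links il _ _ l
    ... | n , lu , lv with NonAmbiguous⇒atom-unique na q q' (labelAtomOf su q n (inj₁ lu)) (labelAtomOf sv q' n (inj₂ lv))
    ... | refl = opposite su sv l lu lv
      where
        atq : IsAtom (sub q)
        atq = n , labelAtomOf su q n (inj₁ lu)
        opposite : ∀ su sv → λ₁ (V su q) (V sv q) → label (V su q) ≡ pos n → label (V sv q) ≡ neg n →
                   idLinking r (V su q) (V sv q)
        opposite sA sA l lu lv = ⊥-elim (pos≢neg lu lv)
        opposite sD sD l lu lv = ⊥-elim (pos≢neg lu lv)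
        opposite sA sD l lu lv with axiomLink-cases q atq
        ... | inj₁ (_ , e) = q , (leaf-InR q (inj₁ (_ , l)) , atq) , sym e
        ... | inj₂ ((_ , e) , _) = ⊥-elim (pos≢neg lu e)
        opposite sD sA l lu lv with axiomLink-cases q atq
        ... | inj₂ (_ , e) = q , (leaf-InR q (inj₂ (_ , l)) , atq) , sym e
        ... | inj₁ ((_ , e) , _) = ⊥-elim (pos≢neg e (dual-pos (trans (sym (sub-mirror q)) lu)))

    λ⊆idLinking : ∀ u v → λ₁ u v → idLinking r u v
    λ⊆idLinking u v l = subst₂ (idLinking r) (V-η u) (V-η v)
      (λ⊆idLinking′ (vside u) (vpos u) (vside v) (vpos v) (subst₂ λ₁ (sym (V-η u)) (sym (V-η v)) l))

    idLinking⊆λ : ∀ u v → idLinking r u v → λ₁ u v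
    idLinking⊆λ u v (q , (i , at) , eq) with proj₁ (ro (V sA q)) (IsAtom⇒IsLeaf sA q at , resOfAdditive⁻ A _ q i)
    ... | inj₁ (y , l) = subst (λ w → λ₁ (proj₁ w) (proj₂ w)) (trans (idLinking-at r sA q (λ⊆idLinking _ _ l) (inj₁ refl)) (sym eq)) l
    ... | inj₂ (y , l) = subst (λ w → λ₁ (proj₁ w) (proj₂ w)) (trans (idLinking-at r sA q (λ⊆idLinking _ _ l) (inj₂ refl)) (sym eq)) l

    forced : Σ[ r' ∈ Res A ] (λ₁ ≈ idLinking r')
    forced = r , λ u v → λ⊆idLinking u v , idLinking⊆λ u v

  identity-unique : ∀ θ → IsProofNet (idSeq A) θ → θ ≐ IdNet A
  identity-unique θ pn = θ⊆IdNet , IdNet⊆θ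
    where
      θ⊆IdNet : θ ⊆ IdNet A
      θ⊆IdNet λ₁ h with Forced.forced λ₁ (IsProofNet.linkings pn λ₁ h)
      ... | r , e = λ₁ , idLinking⇒IdNet λ₁ r e , ≈-refl
      -- θ has a linking on the &-resolution of idLinking r, and it is forced to be idLinking r itself.
      IdNet⊆θ : IdNet A ⊆ θ
      IdNet⊆θ λ₁ h with IdNet⇒idLinking λ₁ h
      ... | r , e with IsProofNet.P1 pn (resChoice r)
      ... | λ₂ , λ₂∈θ , ow , _ with Forced.forced λ₂ (IsProofNet.linkings pn λ₂ λ₂∈θ)
      ... | r' , e' = λ₂ , λ₂∈θ , ≈-trans e (subst (λ z → idLinking z ≈ λ₂) r'≡r (≈-sym e'))
        where
          r'≡r : r' ≡ r
          r'≡r = trans (OnWRes⇒≡resOn (resChoice r) r' λ₂ e' ow)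
                       (sym (OnWRes⇒≡resOn (resChoice r) r (idLinking r) ≈-refl (idLinking-OnWRes r)))

-- Mirroring swaps the two premises of every vertex of A^⊥.
sideIn : Concl → Side → Side
sideIn sA t = t
sideIn sD t = flipSide t

sideIn-involutive : ∀ σ t → sideIn σ (sideIn σ t) ≡ t
sideIn-involutive sA t = refl
sideIn-involutive sD t = flipSide-involutive t

dualK : Conn → Conn
dualK tensor = par
dualK par = tensor
dualK with' = plus
dualK plus = with'

connIn : Concl → Conn → Conn
connIn sA k = k
connIn sD k = dualK k

dualBin : ∀ {F k B C} → F ≡ bin k B C → dual F ≡ bin (dualK k) (dual C) (dual B)
dualBin {k = tensor} refl = refl
dualBin {k = par} refl = refl
dualBin {k = with'} refl = refl
dualBin {k = plus} refl = refl

dualBin⁻ : ∀ {F} → IsBin (dual F) → IsBin F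
dualBin⁻ {pos n} (_ , _ , _ , ())
dualBin⁻ {neg n} (_ , _ , _ , ())
dualBin⁻ {bin k B C} _ = k , B , C , refl

binInj : ∀ {k k' B B' C C'} → bin k B C ≡ bin k' B' C' → k ≡ k'
binInj refl = refl

module _ {A : Formula} where

  Premise⇒child : ∀ {t a b} → Premise {idSeq A} t a b →
          Σ[ σ ∈ Concl ] Σ[ y ∈ Pos A ] (IsBin (sub y) × a ≡ V σ (child (sideIn σ t) y) × b ≡ V σ y)
  Premise⇒child {t} (prem {fz} {p} {q} pr) =
    sD , unmirror q , dualBin⁻ (subst IsBin (trans (cong sub (sym (mirror-unmirror q))) (sub-mirror (unmirror q))) (Prem⇒IsBin pr))
       , cong (vtx fz) (trans (Prem⇒≡child pr)
           (sym (trans (mirror-child (flipSide t) (unmirror q)) (cong₂ (λ s z → child s z) (flipSide-involutive t) (mirror-unmirror q)))))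
       , cong (vtx fz) (sym (mirror-unmirror q))
  Premise⇒child {t} (prem {fs fz} {p} {q} pr) = sA , q , Prem⇒IsBin pr , cong (vtx (fs fz)) (Prem⇒≡child pr) , refl

  IsBin-mirror : ∀ (y : Pos A) → IsBin (sub y) → IsBin (sub (mirror y))
  IsBin-mirror y (k , B , C , e) = dualK k , dual C , dual B , trans (sub-mirror y) (dualBin e)

  child-Premise : ∀ σ t (y : Pos A) → IsBin (sub y) → Premise (sideIn σ t) (V σ (child t y)) (V σ y)
  child-Premise sA t y b = prem (child-Prem t y b)
  child-Premise sD t y b = subst (λ z → Premise (flipSide t) (vtx fz z) (vtx fz (mirror y))) (sym (mirror-child t y))
    (prem (child-Prem (flipSide t) (mirror y) (IsBin-mirror y b)))

  Premise-functional : ∀ {t a a' b} → Premise {idSeq A} t a b → Premise t a' b → a ≡ a'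
  Premise-functional p1 p2 with Premise⇒child p1 | Premise⇒child p2
  ... | σ , y , _ , ea , eb | σ' , y' , _ , ea' , eb' with V-inj (trans (sym eb) eb')
  ... | refl , refl = trans ea (sym ea')

  label-conn : ∀ σ (y : Pos A) {k B C} → sub y ≡ bin k B C → HasConn (connIn σ k) (label (V σ y))
  label-conn sA y {k} {B} {C} e = B , C , e
  label-conn sD y {k} {B} {C} e = dual C , dual B , trans (sub-mirror y) (dualBin e)

  label-conn⁻ : ∀ σ (y : Pos A) {k k' B C} → sub y ≡ bin k B C → HasConn k' (label (V σ y)) → k' ≡ connIn σ k
  label-conn⁻ sA y e (B' , C' , e') = sym (binInj (trans (sym e) e'))
  label-conn⁻ sD y e (B' , C' , e') = sym (binInj (trans (sym (trans (sub-mirror y) (dualBin e))) e'))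

InR-additive-exclusive : ∀ {F} (r : Res F) (p : Pos F) {k B C} → sub p ≡ bin k B C → Add k → InR r (child L p) → InR r (child R p) → ⊥
InR-additive-exclusive (rb m r1 r2) root refl a i1 i2 with m | a
... | mT | ()
... | mP | ()
InR-additive-exclusive (rl _ r1) root refl a i1 ()
InR-additive-exclusive (rr _ r2) root refl a () i2
InR-additive-exclusive (rb _ r1 r2) (inl p) e a i1 i2 = InR-additive-exclusive r1 p e a i1 i2
InR-additive-exclusive (rb _ r1 r2) (inr p) e a i1 i2 = InR-additive-exclusive r2 p e a i1 i2
InR-additive-exclusive (rl _ r1) (inl p) e a i1 i2 = InR-additive-exclusive r1 p e a i1 i2
InR-additive-exclusive (rr _ r2) (inr p) e a i1 i2 = InR-additive-exclusive r2 p e a i1 i2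

InR-mul-both : ∀ {F} (r : Res F) (p : Pos F) {k B C} → sub p ≡ bin k B C → Mul k → InR r p → ∀ t → InR r (child t p)
InR-mul-both (rb _ r1 r2) root refl m _ L = tt
InR-mul-both (rb _ r1 r2) root refl m _ R = tt
InR-mul-both (rl a r1) root refl m _ t with m | a
... | mT | ()
... | mP | ()
InR-mul-both (rr a r1) root refl m _ t with m | a
... | mT | ()
... | mP | ()
InR-mul-both (rb _ r1 r2) (inl p) e m i t = InR-mul-both r1 p e m i t
InR-mul-both (rb _ r1 r2) (inr p) e m i t = InR-mul-both r2 p e m i t
InR-mul-both (rl _ r1) (inl p) e m i t = InR-mul-both r1 p e m i t
InR-mul-both (rr _ r2) (inr p) e m i t = InR-mul-both r2 p e m i t

InR-additive-some : ∀ {F} (r : Res F) (p : Pos F) {k B C} → sub p ≡ bin k B C → Add k → InR r p → Σ[ t ∈ Side ] InR r (child t p)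
InR-additive-some (rb m r1 r2) root refl a _ with m | a
... | mT | ()
... | mP | ()
InR-additive-some (rl _ r1) root refl a _ = L , tt
InR-additive-some (rr _ r2) root refl a _ = R , tt
InR-additive-some (rb _ r1 r2) (inl p) e a i = InR-additive-some r1 p e a i
InR-additive-some (rb _ r1 r2) (inr p) e a i = InR-additive-some r2 p e a i
InR-additive-some (rl _ r1) (inl p) e a i = InR-additive-some r1 p e a i
InR-additive-some (rr _ r2) (inr p) e a i = InR-additive-some r2 p e a i

InR-additive-unique : ∀ {F} (r : Res F) (p : Pos F) {k B C} → sub p ≡ bin k B C → Add k → ∀ t t' → InR r (child t p) → InR r (child t' p) → t ≡ t'
InR-additive-unique r p e a L L _ _ = refl
InR-additive-unique r p e a R R _ _ = refl
InR-additive-unique r p e a L R i1 i2 = ⊥-elim (InR-additive-exclusive r p e a i1 i2)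
InR-additive-unique r p e a R L i1 i2 = ⊥-elim (InR-additive-exclusive r p e a i2 i1)

crossing-child : ∀ {F} {p w : Pos F} t t0 → p ≼ w → child t0 p ≼ child t w → ¬ (child t0 p ≼ w) → IsBin (sub p) → w ≡ p × t ≡ t0
crossing-child {p = p} {w} t t0 pw h nh b with ≼-split pw
crossing-child {p = p} t L pw h nh b | inj₁ refl with t
... | L = refl , refl
... | R = ⊥-elim (children⇒¬IsBin p h ≼-refl b)
crossing-child {p = p} t R pw h nh b | inj₁ refl with t
... | L = ⊥-elim (children⇒¬IsBin p ≼-refl h b)
... | R = refl , refl
crossing-child t L pw h nh b | inj₂ (_ , inj₁ x) = ⊥-elim (nh x)
crossing-child {p = p} {w} t L pw h nh b | inj₂ (_ , inj₂ x) = ⊥-elim (children⇒¬IsBin p h (≼-trans x (≼-child t w)) b)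
crossing-child {p = p} {w} t R pw h nh b | inj₂ (_ , inj₁ x) = ⊥-elim (children⇒¬IsBin p (≼-trans x (≼-child t w)) h b)
crossing-child t R pw h nh b | inj₂ (_ , inj₂ x) = ⊥-elim (nh x)

other : Concl → Concl
other sA = sD
other sD = sA

≢⇒other : ∀ {σ σ'} → σ ≢ σ' → σ' ≡ other σ
≢⇒other {sA} {sA} ne = ⊥-elim (ne refl)
≢⇒other {sA} {sD} ne = refl
≢⇒other {sD} {sA} ne = refl
≢⇒other {sD} {sD} ne = ⊥-elim (ne refl)

module _ {A : Formula} where

  idLinking-endpoints : ∀ (r : Res A) {u v} → idLinking r u v → Σ[ x ∈ Pos A ] (LeafR r x × vpos u ≡ x × vpos v ≡ x × vside u ≢ vside v)
  idLinking-endpoints r {u} {v} (x , lr , eq) with axiomLink-cases x (proj₂ lr)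
  ... | inj₁ (_ , e) with trans eq e
  ... | refl = x , lr , vpos-V sA x , vpos-V sD x , λ ()
  idLinking-endpoints r {u} {v} (x , lr , eq) | inj₂ (_ , e) with trans eq e
  ... | refl = x , lr , vpos-V sD x , vpos-V sA x , λ ()

  idLinking-opposite : ∀ (r : Res A) {u v} → idLinking r u v → vside u ≢ vside v
  idLinking-opposite r lk with idLinking-endpoints r lk
  ... | _ , _ , _ , _ , opposite = opposite

  Premise-above : ∀ {t u v} → Premise {idSeq A} t u v → vpos v ≼ vpos u × ¬ (vpos u ≼ vpos v) × vside u ≡ vside v
  Premise-above {t} pr with Premise⇒child pr
  ... | σ , y , b , refl , refl =
        subst₂ _≼_ (sym (vpos-V σ y)) (sym (vpos-V σ (child (sideIn σ t) y))) (≼-child _ y)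
      , subst₂ (λ a c → ¬ (a ≼ c)) (sym (vpos-V σ (child (sideIn σ t) y))) (sym (vpos-V σ y)) (child⋠ _ y b)
      , trans (vside-V σ _) (sym (vside-V σ y))

parConcl : ∀ {k} → Mul k → Concl
parConcl mT = sD
parConcl mP = sA

module _ {A : Formula} where

  Premise⇒≡child : ∀ {t y σ} {p : Pos A} → Premise t y (V σ p) → y ≡ V σ (child (sideIn σ t) p)
  Premise⇒≡child {t} {σ = σ} pr with Premise⇒child pr
  ... | σ1 , y1 , _ , ey , ep with V-inj ep
  ... | refl , refl = ey

  parConcl-IsPar : ∀ {k B C} (m : Mul k) (p : Pos A) → sub p ≡ bin k B C → IsPar (V (parConcl m) p)
  parConcl-IsPar mT p e = label-conn sD p e
  parConcl-IsPar mP p e = label-conn sA p e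

  additive-¬IsPar : ∀ {k B C} (a : Add k) σ (p : Pos A) → sub p ≡ bin k B C → ¬ IsPar (V σ p)
  additive-¬IsPar aW σ p e ip with label-conn⁻ σ p e ip
  additive-¬IsPar aW sA p e ip | ()
  additive-¬IsPar aW sD p e ip | ()
  additive-¬IsPar aP σ p e ip with label-conn⁻ σ p e ip
  additive-¬IsPar aP sA p e ip | ()
  additive-¬IsPar aP sD p e ip | ()

  other-parConcl-¬IsPar : ∀ {k B C} (m : Mul k) (p : Pos A) → sub p ≡ bin k B C → ¬ IsPar (V (other (parConcl m)) p)
  other-parConcl-¬IsPar mT p e ip with label-conn⁻ sA p e ip
  ... | ()
  other-parConcl-¬IsPar mP p e ip with label-conn⁻ sD p e ip
  ... | ()

-- P2: switching graphs are trees

module SwitchingGraph {A : Formula} (r : Res A) (λ₁ : Linking (idSeq A)) (eqv : λ₁ ≈ idLinking r) (s : ParSwitching (idSeq A)) where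
  E : Edge (idSeq A) → Set₁
  E = switchEdges λ₁ s

  open Walks E

  TreeEdge : Edge (idSeq A) → Vertex (idSeq A) → Vertex (idSeq A) → Set
  TreeEdge e u v = Σ[ t ∈ Side ] (Premise t u v × e ≡ (treeE , u , v) × InR r (vpos u) × ¬ (IsPar v × s v ≡ t))

  LinkEdge : Edge (idSeq A) → Vertex (idSeq A) → Vertex (idSeq A) → Set
  LinkEdge e u v = idLinking r u v × e ≡ (linkE , u , v)

  classify : ∀ e {u v} → E e → Connects e u v → TreeEdge e u v ⊎ TreeEdge e v u ⊎ LinkEdge e u v ⊎ LinkEdge e v u
  classify (treeE , a , b) (lift (t , pr , ir , np)) (inj₁ (refl , refl)) = inj₁ (t , pr , refl , inResOf-≈⁻ r eqv a ir , np)
  classify (treeE , a , b) (lift (t , pr , ir , np)) (inj₂ (refl , refl)) = inj₂ (inj₁ (t , pr , refl , inResOf-≈⁻ r eqv a ir , np))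
  classify (linkE , a , b) (lift l) (inj₁ (refl , refl)) = inj₂ (inj₂ (inj₁ (proj₁ (eqv a b) l , refl)))
  classify (linkE , a , b) (lift l) (inj₂ (refl , refl)) = inj₂ (inj₂ (inj₂ (proj₁ (eqv a b) l , refl)))
  classify (jumpE , a , b) (lift ()) _

  no-self-loop : ∀ e x y → E e → Connects e x y → x ≢ y
  no-self-loop e x y Ee c with classify e Ee c
  ... | inj₁ (_ , pr , _) = λ { refl → proj₁ (proj₂ (Premise-above pr)) ≼-refl }
  ... | inj₂ (inj₁ (_ , pr , _)) = λ { refl → proj₁ (proj₂ (Premise-above pr)) ≼-refl }
  ... | inj₂ (inj₂ (inj₁ (lk , _))) = λ { refl → idLinking-opposite r lk refl }
  ... | inj₂ (inj₂ (inj₂ (lk , _))) = λ { refl → idLinking-opposite r lk refl }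

  link-edge : ∀ {e u v} (p : Pos A) → LinkEdge e u v → vpos u ≡ p → e ≡ (linkE , proj₁ (axiomLink p) , proj₂ (axiomLink p))
  link-edge p (l@(x , _ , eq) , refl) vp =
    cong (λ w → (linkE , proj₁ w , proj₂ w)) (trans eq (cong axiomLink (trans (sym (proj₁ (idLinking-vpos r l))) vp)))

  module _ (C : Cycle E) where
    vs : List (Vertex (idSeq A))
    vs = verts E (Cycle.walk C)

    es : List (Edge (idSeq A))
    es = edges E (Cycle.walk C)

    cycle-inRes : ∀ v → v ∈ vs → InR r (vpos v)
    cycle-inRes v v∈ with vertex-edge (Cycle.walk C) v∈
    ... | e , _ , Ee , y , lift c with classify e Ee c
    ... | inj₁ (_ , _ , _ , ir , _) = ir
    ... | inj₂ (inj₁ (_ , pr , _ , ir , _)) = InR-≼-closed r (proj₁ (Premise-above pr)) ir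
    ... | inj₂ (inj₂ (inj₁ (lk , _))) with idLinking-endpoints r lk
    ... | x , (i , _) , e1 , _ , _ = subst (InR r) (sym e1) i
    cycle-inRes v v∈ | e , _ , Ee , y , lift c | inj₂ (inj₂ (inj₂ (lk , _))) with idLinking-endpoints r lk
    ... | x , (i , _) , _ , e2 , _ = subst (InR r) (sym e2) i

    AllAbove : Pos A → Set
    AllAbove p = ∀ v → v ∈ vs → p ≼ vpos v

    incident-binary : ∀ (p : Pos A) σ → IsBin (sub p) → AllAbove p → ∀ e → IncidentAt C e (V σ p) →
                      Σ[ t ∈ Side ] Σ[ y ∈ Vertex (idSeq A) ]
                        (Premise t y (V σ p) × e ≡ (treeE , y , V σ p) × InR r (vpos y) × ¬ (IsPar (V σ p) × s (V σ p) ≡ t))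
    incident-binary p σ b above e (Ee , y , lift (c , y∈ , ny)) with classify e Ee c
    ... | inj₁ (t , pr , _) = ⊥-elim (proj₁ (proj₂ (Premise-above pr)) (subst (_≼ vpos y) (sym (vpos-V σ p)) (above y y∈)))
    ... | inj₂ (inj₁ (t , pr , eq , ir , np)) = t , y , pr , eq , ir , np
    ... | inj₂ (inj₂ (inj₁ (lk , _))) with idLinking-endpoints r lk
    ... | x , (_ , at) , e1 , _ , _ = ⊥-elim (IsBin⇒¬IsAtom b (subst (λ z → IsAtom (sub z)) (trans (sym e1) (vpos-V σ p)) at))
    incident-binary p σ b above e (Ee , y , lift (c , y∈ , ny)) | inj₂ (inj₂ (inj₂ (lk , _))) with idLinking-endpoints r lk
    ... | x , (_ , at) , _ , e2 , _ = ⊥-elim (IsBin⇒¬IsAtom b (subst (λ z → IsAtom (sub z)) (trans (sym e2) (vpos-V σ p)) at))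

    additive-∉cycle : ∀ (p : Pos A) {k B₀ C₀} → sub p ≡ bin k B₀ C₀ → Add k → AllAbove p → ∀ σ → V σ p ∈ vs → ⊥
    additive-∉cycle p {k} {B} {C'} eqp a above σ v∈ = ¬two-edges (two-incident-edges Vertex-≡-dec no-self-loop C v∈)
      where
        b : IsBin (sub p)
        b = k , B , C' , eqp
        ¬two-edges : TwoIncidentEdges C (V σ p) → ⊥
        ¬two-edges (e , e' , e∈ , e'∈ , ne , inc , inc') with incident-binary p σ b above e inc | incident-binary p σ b above e' inc'
        ... | t , y , pr , refl , ir , _ | t' , y' , pr' , refl , ir' , _ with Premise⇒≡child pr | Premise⇒≡child pr'
        ... | refl | refl with InR-additive-unique r p eqp a (sideIn σ t) (sideIn σ t') (subst (InR r) (vpos-V σ _) ir) (subst (InR r) (vpos-V σ _) ir')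
        ... | tt' = ne (cong (λ z → (treeE , V σ (child z p) , V σ p)) tt')

    par-∉cycle : ∀ (p : Pos A) {k B₀ C₀} → sub p ≡ bin k B₀ C₀ → (m : Mul k) → AllAbove p → V (parConcl m) p ∈ vs → ⊥
    par-∉cycle p {k} {B} {C'} eqp m above v∈ = ¬two-edges (two-incident-edges Vertex-≡-dec no-self-loop C v∈)
      where
        b : IsBin (sub p)
        b = k , B , C' , eqp
        ip : IsPar (V (parConcl m) p)
        ip = parConcl-IsPar m p eqp
        ¬two-edges : TwoIncidentEdges C (V (parConcl m) p) → ⊥
        ¬two-edges (e , e' , e∈ , e'∈ , ne , inc , inc') with incident-binary p (parConcl m) b above e inc | incident-binary p (parConcl m) b above e' inc'
        ... | t , y , pr , eq , ir , np | t' , y' , pr' , eq' , ir' , np' with ≢-same⇒≡ (λ x → np (ip , sym x)) (λ x → np' (ip , sym x))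
        ... | refl with Premise-functional pr pr'
        ... | refl = ne (trans eq (sym eq'))

    atom-¬AllAbove : ∀ (p : Pos A) → IsAtom (sub p) → ¬ AllAbove p
    atom-¬AllAbove p at above = ¬two-edges (two-incident-edges Vertex-≡-dec no-self-loop C v∈)
      where
        σ : Concl
        σ = vside (Cycle.start C)
        v∈ : V σ p ∈ vs
        v∈ = subst (_∈ vs) (vpos⇒V _ p (atom-maximal at (above _ (start∈ C)))) (start∈ C)
        vpos≡p : ∀ y → y ∈ vs → vpos y ≡ p
        vpos≡p y y∈ = atom-maximal at (above y y∈)
        the-link-edge : ∀ e → IncidentAt C e (V σ p) → e ≡ (linkE , proj₁ (axiomLink p) , proj₂ (axiomLink p))
        the-link-edge e (Ee , y , lift (c , y∈ , ny)) with classify e Ee c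
        ... | inj₁ (t , pr , _) = ⊥-elim (proj₁ (proj₂ (Premise-above pr)) (subst₂ _≼_ (sym (vpos-V σ p)) (sym (vpos≡p y y∈)) ≼-refl))
        ... | inj₂ (inj₁ (t , pr , _)) = ⊥-elim (proj₁ (proj₂ (Premise-above pr)) (subst₂ _≼_ (sym (vpos≡p y y∈)) (sym (vpos-V σ p)) ≼-refl))
        ... | inj₂ (inj₂ (inj₁ cl)) = link-edge p cl (vpos-V σ p)
        ... | inj₂ (inj₂ (inj₂ cl)) = link-edge p cl (vpos≡p y y∈)
        ¬two-edges : TwoIncidentEdges C (V σ p) → ⊥
        ¬two-edges (e , e' , e∈ , e'∈ , ne , inc , inc') = ne (trans (the-link-edge e inc) (sym (the-link-edge e' inc')))

    additive-above-child : ∀ (p : Pos A) {k B₀ C₀} → sub p ≡ bin k B₀ C₀ → Add k → AllAbove p →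
                           ∀ {t} → InR r (child t p) → AllAbove (child t p)
    additive-above-child p eqp a above {t} ic v v∈ with ≼-split (above v v∈)
    ... | inj₁ e = ⊥-elim (additive-∉cycle p eqp a above (vside v) (subst (_∈ vs) (vpos⇒V v p e) v∈))
    ... | inj₂ (_ , inj₁ h) with InR-additive-unique r p eqp a L t (InR-≼-closed r h (cycle-inRes v v∈)) ic
    ...   | refl = h
    additive-above-child p eqp a above {t} ic v v∈ | inj₂ (_ , inj₂ h) with InR-additive-unique r p eqp a R t (InR-≼-closed r h (cycle-inRes v v∈)) ic
    ...   | refl = h

    -- Above a ⊗/⅋ position p the ⅋ copy of p is off the cycle, so the only edge between the subtree of a
    -- child and the rest is the ⊗ premise edge; a cycle would have to cross it twice.
    module MulVertex (p : Pos A) {k B₀ C₀} (eqp : sub p ≡ bin k B₀ C₀) (m : Mul k) (above : AllAbove p) where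
      σ⊗ : Concl
      σ⊗ = other (parConcl m)

      InSubtree : Side → Vertex (idSeq A) → Set
      InSubtree t v = child t p ≼ vpos v

      crossing-edge : ∀ t e → e ∈ es → Crossing (InSubtree t) (λ v → ≼-dec _ (vpos v)) e →
                      e ≡ (treeE , V σ⊗ (child t p) , V σ⊗ p)
      crossing-edge t e e∈ (Ee , x , y , lift (c , px , npy)) with classify e Ee c | proj₂ (cycle-edge-endpoints∈ (Cycle.walk C) (Cycle.nonempty C) e∈ c)
      ... | inj₁ (t' , pr , eq , _) | y∈ with Premise⇒child pr
      ... | σ1 , y1 , b1 , refl , refl with crossing-child (sideIn σ1 t') t (subst (p ≼_) (vpos-V σ1 y1) (above _ y∈))
                                              (subst (child t p ≼_) (vpos-V σ1 _) px)
                                              (λ h → npy (subst (child t p ≼_) (sym (vpos-V σ1 y1)) h)) (k , B₀ , C₀ , eqp)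
      ... | refl , refl with ≢⇒other {parConcl m} {σ1} (λ { refl → par-∉cycle p eqp m above y∈ })
      ... | refl = eq
      crossing-edge t e e∈ (Ee , x , y , lift (c , px , npy)) | inj₂ (inj₁ (_ , pr , _)) | _ = ⊥-elim (npy (≼-trans px (proj₁ (Premise-above pr))))
      crossing-edge t e e∈ (Ee , x , y , lift (c , px , npy)) | inj₂ (inj₂ (inj₁ (lk , _))) | _ with idLinking-endpoints r lk
      ... | _ , _ , e1 , e2 , _ = ⊥-elim (npy (subst (child t p ≼_) (trans e1 (sym e2)) px))
      crossing-edge t e e∈ (Ee , x , y , lift (c , px , npy)) | inj₂ (inj₂ (inj₂ (lk , _))) | _ with idLinking-endpoints r lk
      ... | _ , _ , e1 , e2 , _ = ⊥-elim (npy (subst (child t p ≼_) (trans e2 (sym e1)) px))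

      ¬crossing : ∀ t {a b} → a ∈ vs → InSubtree t a → b ∈ vs → ¬ InSubtree t b → ⊥
      ¬crossing t a∈ pa b∈ npb with two-crossings (InSubtree t) (λ v → ≼-dec _ (vpos v)) C a∈ pa b∈ npb
      ... | e , e' , e∈ , e'∈ , ne , cr , cr' = ne (trans (crossing-edge t e e∈ cr) (sym (crossing-edge t e' e'∈ cr')))

      all-or-none : ∀ t → AllAbove (child t p) ⊎ (∀ v → v ∈ vs → ¬ InSubtree t v)
      all-or-none t with ≼-dec (child t p) (vpos (Cycle.start C))
      ... | yes s∈ = inj₁ λ v v∈ → all (≼-dec (child t p) (vpos v)) v∈
        where
          all : ∀ {v} → Dec (InSubtree t v) → v ∈ vs → InSubtree t v
          all (yes h) _ = h
          all (no h) v∈ = ⊥-elim (¬crossing t (start∈ C) s∈ v∈ h)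
      ... | no s∉ = inj₂ λ v v∈ h → ¬crossing t v∈ h (start∈ C) s∉

      none⇒at-⊗ : (∀ t v → v ∈ vs → ¬ InSubtree t v) → ∀ v → v ∈ vs → v ≡ V σ⊗ p
      none⇒at-⊗ none v v∈ with ≼-split (above v v∈)
      ... | inj₂ (_ , inj₁ h) = ⊥-elim (none L v v∈ h)
      ... | inj₂ (_ , inj₂ h) = ⊥-elim (none R v v∈ h)
      ... | inj₁ e with ≢⇒other {parConcl m} {vside v}
                         (λ eq → par-∉cycle p eqp m above (subst (_∈ vs) (trans (vpos⇒V v p e) (cong (λ z → V z p) (sym eq))) v∈))
      ... | eq' = trans (vpos⇒V v p e) (cong (λ z → V z p) eq')

    descend : ∀ F (p : Pos A) → sub p ≡ F → InR r p → ¬ AllAbove p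
    descend-child : ∀ {k} B₀ C₀ (p : Pos A) → sub p ≡ bin k B₀ C₀ → ∀ t → InR r (child t p) → ¬ AllAbove (child t p)

    descend-child B₀ C₀ p eqp L = descend B₀ (child L p) (proj₁ (sub-children p eqp))
    descend-child B₀ C₀ p eqp R = descend C₀ (child R p) (proj₂ (sub-children p eqp))

    descend (pos n) p eqp _ = atom-¬AllAbove p (n , inj₁ eqp)
    descend (neg n) p eqp _ = atom-¬AllAbove p (n , inj₂ eqp)
    descend (bin k B₀ C₀) p eqp ip above with mul⊎add k
    ... | inj₂ a with InR-additive-some r p eqp a ip
    ...   | t , ic = descend-child B₀ C₀ p eqp t ic (additive-above-child p eqp a above ic)
    descend (bin k B₀ C₀) p eqp ip above | inj₁ m with all-or-none L | all-or-none R
      where open MulVertex p eqp m above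
    ... | inj₁ allL | _ = descend-child B₀ C₀ p eqp L (InR-mul-both r p eqp m ip L) allL
    ... | inj₂ _ | inj₁ allR = descend-child B₀ C₀ p eqp R (InR-mul-both r p eqp m ip R) allR
    ... | inj₂ noneL | inj₂ noneR = ¬single-vertex no-self-loop C _ (none⇒at-⊗ λ { L → noneL ; R → noneR })
      where open MulVertex p eqp m above

  acyclic : ¬ Cycle E
  acyclic C = descend C A root refl tt (λ _ _ → ≼root)

  tree-step : ∀ σ t (p : Pos A) → IsBin (sub p) → InR r (child t p) → ¬ (IsPar (V σ p) × s (V σ p) ≡ sideIn σ t) → Walk E (V σ (child t p)) (V σ p)
  tree-step σ t p b ir np = single (treeE , V σ (child t p) , V σ p)
    (lift (sideIn σ t , child-Premise σ t p b , inResOf-≈⁺ r eqv (V σ (child t p)) (subst (InR r) (sym (vpos-V σ (child t p))) ir) , np))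
    (inj₁ (refl , refl))

  link-step : ∀ (p : Pos A) → LeafR r p → Walk E (V sD p) (V sA p)
  link-step p lr with axiomLink-cases p (proj₂ lr)
  ... | inj₁ (_ , e) = single (linkE , V sA p , V sD p) (lift (proj₂ (eqv _ _) (p , lr , sym e))) (inj₂ (refl , refl))
  ... | inj₂ (_ , e) = single (linkE , V sD p , V sA p) (lift (proj₂ (eqv _ _) (p , lr , sym e))) (inj₁ (refl , refl))

  walk-from : ∀ {p : Pos A} v {Z} → vpos v ≡ p → Walk E (V (vside v) p) Z → Walk E v Z
  walk-from {p} v {Z} e w = subst (λ z → Walk E z Z) (trans (cong (V (vside v)) (sym e)) (V-η v)) w

  IsPar⇒parConcl : ∀ {σ k B C} (m : Mul k) (p : Pos A) → sub p ≡ bin k B C → IsPar (V σ p) → σ ≡ parConcl m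
  IsPar⇒parConcl {σ} m p eqp isPar with Concl-≟ σ (parConcl m)
  ... | yes eq = eq
  ... | no ne = ⊥-elim (other-parConcl-¬IsPar m p eqp (subst (λ z → IsPar (V z p)) (≢⇒other (λ e → ne (sym e))) isPar))

  -- The child of p through which its two copies are connected: the surviving the-link-edge for an additive p,
  -- the the-link-edge kept by s at the ⅋ copy for a multiplicative p.
  through : ∀ (p : Pos A) {k B₀ C₀} → sub p ≡ bin k B₀ C₀ → InR r p →
            Σ[ t ∈ Side ] (InR r (child t p) × ∀ σ → ¬ (IsPar (V σ p) × s (V σ p) ≡ sideIn σ t))
  through p {k} eqp ip with mul⊎add k
  ... | inj₂ a with InR-additive-some r p eqp a ip
  ...   | t , it = t , it , λ σ (isPar , _) → additive-¬IsPar a σ p eqp isPar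
  through p eqp ip | inj₁ m = kept , InR-mul-both r p eqp m ip kept , free
    where
      kept : Side
      kept = sideIn (parConcl m) (flipSide (s (V (parConcl m) p)))
      free : ∀ σ → ¬ (IsPar (V σ p) × s (V σ p) ≡ sideIn σ kept)
      free σ (isPar , eq) with IsPar⇒parConcl {σ} m p eqp isPar
      ... | refl = flipSide-≢ (s (V σ p)) (sym (trans eq (sideIn-involutive σ _)))

  copies : ∀ F (p : Pos A) → sub p ≡ F → InR r p → Walk E (V sD p) (V sA p)
  copies (pos n) p eqp ip = link-step p (ip , n , inj₁ eqp)
  copies (neg n) p eqp ip = link-step p (ip , n , inj₂ eqp)
  copies (bin k B₀ C₀) p eqp ip with through p eqp ip
  ... | t , it , free =
    reverse (tree-step sD t p (_ , _ , _ , eqp) it (free sD)) ++ʷ copies-child t it ++ʷ tree-step sA t p (_ , _ , _ , eqp) it (free sA)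
    where
      copies-child : ∀ t → InR r (child t p) → Walk E (V sD (child t p)) (V sA (child t p))
      copies-child L = copies B₀ (child L p) (proj₁ (sub-children p eqp))
      copies-child R = copies C₀ (child R p) (proj₂ (sub-children p eqp))

  -- If the premise edge t of the ⅋ copy in A is switched off, detour through the ⊗ copy in A^⊥.
  child-up : ∀ (p : Pos A) {k B₀ C₀} → sub p ≡ bin k B₀ C₀ → InR r p →
             ∀ t → InR r (child t p) → Walk E (V sA (child t p)) (V sA p)
  child-up p {k} eqp ip t it with mul⊎add k
  ... | inj₂ a = tree-step sA t p (_ , _ , _ , eqp) it (λ (isPar , _) → additive-¬IsPar a sA p eqp isPar)
  ... | inj₁ m with Concl-≟ sA (parConcl m) | Side≟ (s (V sA p)) t
  ...   | no sA≢⅋ | _ = tree-step sA t p (_ , _ , _ , eqp) it (λ (isPar , _) → sA≢⅋ (IsPar⇒parConcl m p eqp isPar))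
  ...   | yes _ | no s≢t = tree-step sA t p (_ , _ , _ , eqp) it (λ (_ , s≡t) → s≢t s≡t)
  ...   | yes sA≡⅋ | yes _ =
          reverse (copies _ (child t p) refl it)
      ++ʷ tree-step sD t p (_ , _ , _ , eqp) it (λ (isPar , _) → sA≢sD (trans sA≡⅋ (sym (IsPar⇒parConcl m p eqp isPar))))
      ++ʷ copies _ p eqp ip

  climb : ∀ F (p : Pos A) → sub p ≡ F → InR r p → ∀ v → InR r (vpos v) → p ≼ vpos v → Walk E v (V sA p)
  climb F p eqp ip v iv pv with ≼-split pv
  ... | inj₁ e = walk-from v e (to-A (vside v))
    where
      to-A : ∀ σ → Walk E (V σ p) (V sA p)
      to-A sA = []
      to-A sD = copies F p eqp ip
  climb (pos n) p eqp _ _ _ _ | inj₂ (b , _) = ⊥-elim (IsBin⇒¬IsAtom b (n , inj₁ eqp))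
  climb (neg n) p eqp _ _ _ _ | inj₂ (b , _) = ⊥-elim (IsBin⇒¬IsAtom b (n , inj₂ eqp))
  climb (bin k B₀ C₀) p eqp ip v iv _ | inj₂ (_ , inj₁ h) =
    climb B₀ (child L p) (proj₁ (sub-children p eqp)) (InR-≼-closed r h iv) v iv h ++ʷ child-up p eqp ip L (InR-≼-closed r h iv)
  climb (bin k B₀ C₀) p eqp ip v iv _ | inj₂ (_ , inj₂ h) =
    climb C₀ (child R p) (proj₂ (sub-children p eqp)) (InR-≼-closed r h iv) v iv h ++ʷ child-up p eqp ip R (InR-≼-closed r h iv)

  connected : Connected E (resVerts λ₁)
  connected u v (lift iu) (lift iv) =
    climb A root refl tt u (inResOf-≈⁻ r eqv u iu) ≼root ++ʷ reverse (climb A root refl tt v (inResOf-≈⁻ r eqv v iv) ≼root)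

module _ {A : Formula} where

  identity-P2 : ∀ λ₁ → IdNet A λ₁ → ∀ (s : ParSwitching (idSeq A)) → IsTree (switchEdges λ₁ s) (resVerts λ₁)
  identity-P2 λ₁ h s with IdNet⇒idLinking λ₁ h
  ... | r , e = SwitchingGraph.connected r λ₁ e s , SwitchingGraph.acyclic r λ₁ e s

-- P3: a toggled & on no switching cycle

-- The copy of a binary position that a switching acts on: its ⅋ copy, or its & copy.
switched : Conn → Concl
switched tensor = sD
switched par = sA
switched with' = sA
switched plus = sD

with-conn⇒switched : ∀ σ k → with' ≡ connIn σ k → σ ≡ switched k
with-conn⇒switched sA with' _ = refl
with-conn⇒switched sD plus _ = refl
with-conn⇒switched sA tensor ()
with-conn⇒switched sA par ()
with-conn⇒switched sA plus ()
with-conn⇒switched sD tensor ()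
with-conn⇒switched sD par ()
with-conn⇒switched sD with' ()

withConcl : ∀ {k} → Add k → Concl
withConcl aW = sA
withConcl aP = sD

module _ {A : Formula} where

  withConcl-IsWith : ∀ (p : Pos A) {k B C} → sub p ≡ bin k B C → (a : Add k) → IsWith (V (withConcl a) p)
  withConcl-IsWith p e aW = label-conn sA p e
  withConcl-IsWith p e aP = label-conn sD p e

  switched-vertex : ∀ (p : Pos A) {k B C} → sub p ≡ bin k B C → IsPar (V (switched k) p) ⊎ IsWith (V (switched k) p)
  switched-vertex p {tensor} e = inj₁ (label-conn sD p e)
  switched-vertex p {par} e = inj₁ (label-conn sA p e)
  switched-vertex p {with'} e = inj₂ (label-conn sA p e)
  switched-vertex p {plus} e = inj₂ (label-conn sD p e)

  IsWith⇒switched : ∀ σ (p : Pos A) {k B C} → sub p ≡ bin k B C → IsWith (V σ p) → σ ≡ switched k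
  IsWith⇒switched σ p {k} e w = with-conn⇒switched σ k (label-conn⁻ σ p e w)

  record Divergence (ρa ρb : Res A) (x : Pos A) : Set where
    constructor divergence
    field
      {conn} : Conn
      {left right} : Formula
      point : Pos A
      side : Side
      point-conn : sub point ≡ bin conn left right
      additive : Add conn
      below : child side point ≼ x
      in-ρa : InR ρa (child side point)
      in-ρb : InR ρb (child (flipSide side) point)

    vertex : Vertex (idSeq A)
    vertex = V (withConcl additive) point

  diverge-here : ∀ (p : Pos A) {k B C} → sub p ≡ bin k B C → (ρa ρb : Res A) → InR ρb p →
                 ∀ x t → child t p ≼ x → InR ρa x → ¬ InR ρb (child t p) → Divergence ρa ρb x
  diverge-here p {k} e ρa ρb ib x t h ia nibt with mul⊎add k
  ... | inj₁ m = ⊥-elim (nibt (InR-mul-both ρb p e m ib t))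
  ... | inj₂ a with InR-additive-some ρb p e a ib
  ...   | t' , i' with Side≟ t' t
  ...     | yes refl = ⊥-elim (nibt i')
  ...     | no ne = divergence p t e a h (InR-≼-closed ρa h ia) (subst (λ z → InR ρb (child z p)) (≢⇒flipSide ne) i')

  diverge : ∀ F (p : Pos A) → sub p ≡ F → (ρa ρb : Res A) → InR ρb p →
            ∀ x → p ≼ x → InR ρa x → ¬ InR ρb x → Divergence ρa ρb x
  diverge (pos n) p e ρa ρb ib x px ia nib with atom-maximal (n , inj₁ e) px
  ... | refl = ⊥-elim (nib ib)
  diverge (neg n) p e ρa ρb ib x px ia nib with atom-maximal (n , inj₂ e) px
  ... | refl = ⊥-elim (nib ib)
  diverge (bin k B C) p e ρa ρb ib x px ia nib with ≼-split px
  ... | inj₁ refl = ⊥-elim (nib ib)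
  ... | inj₂ (_ , inj₁ h) with InR-dec ρb (child L p)
  ...   | yes ibL = diverge B (child L p) (proj₁ (sub-children p e)) ρa ρb ibL x h ia nib
  ...   | no nibL = diverge-here p e ρa ρb ib x L h ia nibL
  diverge (bin k B C) p e ρa ρb ib x px ia nib | inj₂ (_ , inj₂ h) with InR-dec ρb (child R p)
  ...   | yes ibR = diverge C (child R p) (proj₂ (sub-children p e)) ρa ρb ibR x h ia nib
  ...   | no nibR = diverge-here p e ρa ρb ib x R h ia nibR

  divergence-toggles : ∀ (Λ' : LinkingSet (idSeq A)) {λa λb} (ρa ρb : Res A) → Λ' λa → Λ' λb →
                       λa ≈ idLinking ρa → λb ≈ idLinking ρb → ∀ {x} (d : Divergence ρa ρb x) → Toggles Λ' (Divergence.vertex d)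
  divergence-toggles Λ' {λa} {λb} ρa ρb la lb ea eb (divergence p t e a _ ia ib) = withConcl-IsWith p e a , premise
    where
      σ : Concl
      σ = withConcl a
      premise : ∀ t' → Σ[ p' ∈ Vertex (idSeq A) ] (Premise t' p' (V σ p) × inUnion Λ' p')
      premise t' = V σ (child (sideIn σ t') p)
                 , subst (λ z → Premise z (V σ (child (sideIn σ t') p)) (V σ p)) (sideIn-involutive σ t')
                         (child-Premise σ (sideIn σ t') p (_ , _ , _ , e))
                 , in-union (Side≟ (sideIn σ t') t)
        where
          in-union : Dec (sideIn σ t' ≡ t) → inUnion Λ' (V σ (child (sideIn σ t') p))
          in-union (yes eq) = λa , la , inResOf-≈⁺ ρa ea _ (subst (InR ρa) (sym (trans (vpos-V σ _) (cong (λ z → child z p) eq))) ia)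
          in-union (no ne) = λb , lb , inResOf-≈⁺ ρb eb _ (subst (InR ρb) (sym (trans (vpos-V σ _) (cong (λ z → child z p) (≢⇒flipSide ne)))) ib)

  module _ (Λ : LinkingSet (idSeq A)) (hΛ : Λ ⊆ IdNet A) where
    member-idLinking : ∀ {λ₁} → Λ λ₁ → Σ[ r ∈ Res A ] (λ₁ ≈ idLinking r)
    member-idLinking {λ₁} l with hΛ λ₁ l
    ... | λ₂ , idn , e with IdNet⇒idLinking λ₂ idn
    ... | r , e' = r , ≈-trans e e'

    JumpInfo : Vertex (idSeq A) → Vertex (idSeq A) → Set
    JumpInfo l W = vpos W ≼ vpos l × IsAtom (sub (vpos l)) × IsWith W

    Depends⇒JumpInfo : ∀ u v W → Depends Λ u v W → JumpInfo u W × JumpInfo v W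
    -- The & vertex a link depends on is where the two resolutions diverge below that link.
    Depends⇒JumpInfo u v W (λa , λb , la , lb , luv , nluv , tog , uniq) with member-idLinking la | member-idLinking lb
    ... | ρa , ea | ρb , eb with proj₁ (ea u v) luv
    ... | lk@(x , (ix , at) , eq) with diverge A root refl ρa ρb tt x ≼root ix (λ ib → nluv (proj₂ (eb u v) (x , (ib , at) , eq)))
    ... | d with uniq _ (divergence-toggles (pairSet λa λb) ρa ρb (inj₁ refl) (inj₂ refl) ea eb d)
    ... | refl = jump {u} (proj₁ (idLinking-vpos ρa lk)) , jump {v} (proj₂ (idLinking-vpos ρa lk))
      where
        open Divergence d
        jump : ∀ {w} → vpos w ≡ x → JumpInfo w vertex
        jump e = subst (vpos vertex ≼_) (sym e) (subst (_≼ x) (sym (vpos-V (withConcl additive) point)) (≼-trans (≼-child side point) below))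
               , subst (λ z → IsAtom (sub z)) (sym e) at
               , proj₁ tog

between : ∀ {F} {p' w x : Pos F} t → p' ≼ w → w ≼ x → child t p' ≼ x → ¬ (child t p' ≼ w) → IsBin (sub p') → w ≡ p'
between {p' = p'} {w} {x} t pw wx cx ncw b with ≼-split pw
... | inj₁ e = e
between {p' = p'} L pw wx cx ncw b | inj₂ (_ , inj₁ h) = ⊥-elim (ncw h)
between {p' = p'} R pw wx cx ncw b | inj₂ (_ , inj₁ h) = ⊥-elim (children⇒¬IsBin p' (≼-trans h wx) cx b)
between {p' = p'} L pw wx cx ncw b | inj₂ (_ , inj₂ h) = ⊥-elim (children⇒¬IsBin p' cx (≼-trans h wx) b)
between {p' = p'} R pw wx cx ncw b | inj₂ (_ , inj₂ h) = ⊥-elim (ncw h)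

SameRes : ∀ {F} → Res F → Res F → Set
SameRes r1 r2 = ∀ q → (InR r1 q → InR r2 q) × (InR r2 q → InR r1 q)

DiffRes : ∀ {F} → Res F → Res F → Set
DiffRes {F} r1 r2 = Σ[ q ∈ Pos F ] (InR r1 q × ¬ InR r2 q)

mul-add-disjoint : ∀ {k} → Mul k → Add k → ⊥
mul-add-disjoint mT ()
mul-add-disjoint mP ()

compareRes : ∀ {F} (r1 r2 : Res F) → DiffRes r1 r2 ⊎ DiffRes r2 r1 ⊎ SameRes r1 r2
compareRes rpos rpos = inj₂ (inj₂ λ { root → (λ x → x) , (λ x → x) })
compareRes rneg rneg = inj₂ (inj₂ λ { root → (λ x → x) , (λ x → x) })
compareRes (rb m a1 a2) (rb m' b1 b2) with compareRes a1 b1 | compareRes a2 b2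
... | inj₁ (q , i , n) | _ = inj₁ (inl q , i , n)
... | inj₂ (inj₁ (q , i , n)) | _ = inj₂ (inj₁ (inl q , i , n))
... | inj₂ (inj₂ s1) | inj₁ (q , i , n) = inj₁ (inr q , i , n)
... | inj₂ (inj₂ s1) | inj₂ (inj₁ (q , i , n)) = inj₂ (inj₁ (inr q , i , n))
... | inj₂ (inj₂ s1) | inj₂ (inj₂ s2) = inj₂ (inj₂ λ { root → (λ x → x) , (λ x → x) ; (inl q) → s1 q ; (inr q) → s2 q })
compareRes (rl a a1) (rl a' b1) with compareRes a1 b1
... | inj₁ (q , i , n) = inj₁ (inl q , i , n)
... | inj₂ (inj₁ (q , i , n)) = inj₂ (inj₁ (inl q , i , n))
... | inj₂ (inj₂ s1) = inj₂ (inj₂ λ { root → (λ x → x) , (λ x → x) ; (inl q) → s1 q ; (inr q) → (λ ()) , (λ ()) })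
compareRes (rr a a2) (rr a' b2) with compareRes a2 b2
... | inj₁ (q , i , n) = inj₁ (inr q , i , n)
... | inj₂ (inj₁ (q , i , n)) = inj₂ (inj₁ (inr q , i , n))
... | inj₂ (inj₂ s2) = inj₂ (inj₂ λ { root → (λ x → x) , (λ x → x) ; (inr q) → s2 q ; (inl q) → (λ ()) , (λ ()) })
compareRes (rl a a1) (rr a' b2) = inj₁ (inl root , tt , λ ())
compareRes (rr a a2) (rl a' b1) = inj₁ (inr root , tt , λ ())
compareRes (rb m _ _) (rl a _) = ⊥-elim (mul-add-disjoint m a)
compareRes (rb m _ _) (rr a _) = ⊥-elim (mul-add-disjoint m a)
compareRes (rl a _) (rb m _ _) = ⊥-elim (mul-add-disjoint m a)
compareRes (rr a _) (rb m _ _) = ⊥-elim (mul-add-disjoint m a)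

module _ {A : Formula} where
  SameRes⇒≈ : ∀ (r1 r2 : Res A) → SameRes r1 r2 → idLinking r1 ≈ idLinking r2
  SameRes⇒≈ r1 r2 s u v = (λ { (q , (i , at) , eq) → q , (proj₁ (s q) i , at) , eq }) , (λ { (q , (i , at) , eq) → q , (proj₂ (s q) i , at) , eq })

  module CycleInG (Λ : LinkingSet (idSeq A)) (hΛ : Λ ⊆ IdNet A) (SC : SwitchingCycle (GEdges Λ)) where
    E : Edge (idSeq A) → Set₁
    E = GEdges Λ

    open Walks E
    cyc : Cycle E
    cyc = SwitchingCycle.cycle SC
    vs : List (Vertex (idSeq A))
    vs = verts E (Cycle.walk cyc)
    es : List (Edge (idSeq A))
    es = edges E (Cycle.walk cyc)

    LinkPos : Vertex (idSeq A) → Vertex (idSeq A) → Set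
    LinkPos u v = vpos u ≡ vpos v × vside u ≢ vside v × IsAtom (sub (vpos u))

    Cls : Edge (idSeq A) → Vertex (idSeq A) → Vertex (idSeq A) → Set
    Cls e u v = (Σ[ t ∈ Side ] (Premise t u v × e ≡ (treeE , u , v)))
              ⊎ (Σ[ t ∈ Side ] (Premise t v u × e ≡ (treeE , v , u)))
              ⊎ LinkPos u v
              ⊎ (e ≡ (jumpE , u , v) × JumpInfo Λ hΛ u v)
              ⊎ (e ≡ (jumpE , v , u) × JumpInfo Λ hΛ v u)

    link-endpoints : ∀ {u v} → Σ[ λ₁ ∈ Linking (idSeq A) ] (Λ λ₁ × Lift (lsuc lzero) (λ₁ u v)) → LinkPos u v × LinkPos v u
    link-endpoints (λ₁ , l , lift luv) with member-idLinking Λ hΛ l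
    ... | r , e with idLinking-endpoints r (proj₁ (e _ _) luv)
    ... | x , (_ , at) , pu , pv , ns = (trans pu (sym pv) , ns , subst (λ z → IsAtom (sub z)) (sym pu) at)
                                      , (trans pv (sym pu) , (λ z → ns (sym z)) , subst (λ z → IsAtom (sub z)) (sym pv) at)

    jump-info : ∀ {l W} → GEdges Λ (jumpE , l , W) → JumpInfo Λ hΛ l W
    jump-info (u , v , dep , lift (inj₁ refl)) = proj₁ (Depends⇒JumpInfo Λ hΛ u v _ dep)
    jump-info (u , v , dep , lift (inj₂ refl)) = proj₂ (Depends⇒JumpInfo Λ hΛ u v _ dep)

    classify : ∀ e {u v} → E e → Connects e u v → Cls e u v
    classify (treeE , a , b) (t , lift pr , _) (inj₁ (refl , refl)) = inj₁ (t , pr , refl)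
    classify (treeE , a , b) (t , lift pr , _) (inj₂ (refl , refl)) = inj₂ (inj₁ (t , pr , refl))
    classify (linkE , a , b) Ee (inj₁ (refl , refl)) = inj₂ (inj₂ (inj₁ (proj₁ (link-endpoints Ee))))
    classify (linkE , a , b) Ee (inj₂ (refl , refl)) = inj₂ (inj₂ (inj₁ (proj₂ (link-endpoints Ee))))
    classify (jumpE , a , b) Ee (inj₁ (refl , refl)) = inj₂ (inj₂ (inj₂ (inj₁ (refl , jump-info Ee))))
    classify (jumpE , a , b) Ee (inj₂ (refl , refl)) = inj₂ (inj₂ (inj₂ (inj₂ (refl , jump-info Ee))))

    atom-¬IsWith : ∀ {W : Vertex (idSeq A)} → IsAtom (sub (vpos W)) → IsWith W → ⊥
    atom-¬IsWith {W} at (B , C , e) = IsBin⇒¬IsAtom (with' , B , C , e) (atomPos⇒IsLeaf W at)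

    no-self-loop : ∀ e x y → E e → Connects e x y → x ≢ y
    no-self-loop e x y Ee c with classify e Ee c
    ... | inj₁ (_ , pr , _) = λ { refl → proj₁ (proj₂ (Premise-above pr)) ≼-refl }
    ... | inj₂ (inj₁ (_ , pr , _)) = λ { refl → proj₁ (proj₂ (Premise-above pr)) ≼-refl }
    ... | inj₂ (inj₂ (inj₁ (_ , ns , _))) = λ { refl → ns refl }
    ... | inj₂ (inj₂ (inj₂ (inj₁ (_ , (_ , at , w))))) = λ { refl → atom-¬IsWith {x} at w }
    ... | inj₂ (inj₂ (inj₂ (inj₂ (_ , (_ , at , w))))) = λ { refl → atom-¬IsWith {x} at w }

    AllAbove : Pos A → Set
    AllAbove p = ∀ v → v ∈ vs → p ≼ vpos v

    binary-¬atom : ∀ {σ} {p : Pos A} → IsBin (sub p) → IsAtom (sub (vpos (V σ p))) → ⊥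
    binary-¬atom {σ} {p} b at = IsBin⇒¬IsAtom b (subst (λ z → IsAtom (sub z)) (vpos-V σ p) at)

    switched-∉cycle : ∀ (p : Pos A) σ → IsBin (sub p) → AllAbove p → (IsPar (V σ p) ⊎ IsWith (V σ p)) → V σ p ∈ vs → ⊥
    switched-∉cycle p σ b above hk v∈ = ¬two-edges (two-incident-edges Vertex-≡-dec no-self-loop cyc v∈)
      where
        inE : ∀ e → IncidentAt cyc e (V σ p) → InEdge e (V σ p)
        inE e (Ee , y , lift (c , y∈ , ny)) with classify e Ee c
        ... | inj₁ (t , pr , _) = ⊥-elim (proj₁ (proj₂ (Premise-above pr)) (subst (_≼ vpos y) (sym (vpos-V σ p)) (above y y∈)))
        ... | inj₂ (inj₁ (t , pr , eq)) = subst (λ z → InEdge z (V σ p)) (sym eq) refl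
        ... | inj₂ (inj₂ (inj₁ (_ , _ , at))) = ⊥-elim (binary-¬atom {σ} {p} b at)
        ... | inj₂ (inj₂ (inj₂ (inj₁ (_ , (_ , at , _))))) = ⊥-elim (binary-¬atom {σ} {p} b at)
        ... | inj₂ (inj₂ (inj₂ (inj₂ (eq , _)))) = subst (λ z → InEdge z (V σ p)) (sym eq) refl
        ¬two-edges : TwoIncidentEdges cyc (V σ p) → ⊥
        ¬two-edges (e , e' , e∈ , e'∈ , ne , inc , inc') = ne (SwitchingCycle.switching SC (V σ p) hk e e' e∈ e'∈ (inE e inc) (inE e' inc'))

    -- Below an ancestor p' of the toggled &, the switched copy of p' is off the cycle and jumps only
    -- reach & vertices, so the subtree of a child of p' is left only through the other copy's premise edge.
    module Ancestor (p' : Pos A) {k B₀ C₀} (eqp : sub p' ≡ bin k B₀ C₀) (above : AllAbove p') where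
      off : ¬ (V (switched k) p' ∈ vs)
      off = switched-∉cycle p' (switched k) (_ , _ , _ , eqp) above (switched-vertex p' eqp)

      InSubtree : Side → Vertex (idSeq A) → Set
      InSubtree t v = child t p' ≼ vpos v

      crossing-edge : ∀ t e → e ∈ es → Crossing (InSubtree t) (λ v → ≼-dec _ (vpos v)) e →
                      e ≡ (treeE , V (other (switched k)) (child t p') , V (other (switched k)) p')
      crossing-edge t e e∈ (Ee , x , y , lift (c , px , npy)) with classify e Ee c | proj₂ (cycle-edge-endpoints∈ (Cycle.walk cyc) (Cycle.nonempty cyc) e∈ c)
      ... | inj₁ (t' , pr , eq) | y∈ with Premise⇒child pr
      ... | σ1 , y1 , b1 , refl , refl with crossing-child (sideIn σ1 t') t (subst (p' ≼_) (vpos-V σ1 y1) (above _ y∈))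
                                              (subst (child t p' ≼_) (vpos-V σ1 _) px)
                                              (λ h → npy (subst (child t p' ≼_) (sym (vpos-V σ1 y1)) h)) (_ , _ , _ , eqp)
      ... | refl , refl with ≢⇒other {switched k} {σ1} (λ { refl → off y∈ })
      ... | refl = eq
      crossing-edge t e e∈ (Ee , x , y , lift (c , px , npy)) | inj₂ (inj₁ (_ , pr , _)) | _ = ⊥-elim (npy (≼-trans px (proj₁ (Premise-above pr))))
      crossing-edge t e e∈ (Ee , x , y , lift (c , px , npy)) | inj₂ (inj₂ (inj₁ (ep , _))) | _ = ⊥-elim (npy (subst (child t p' ≼_) ep px))
      crossing-edge t e e∈ (Ee , x , y , lift (c , px , npy)) | inj₂ (inj₂ (inj₂ (inj₂ (_ , (wl , _ , _))))) | _ = ⊥-elim (npy (≼-trans px wl))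
      crossing-edge t e e∈ (Ee , x , y , lift (c , px , npy)) | inj₂ (inj₂ (inj₂ (inj₁ (_ , (wl , _ , isw))))) | y∈
        with between t (above y y∈) wl px npy (_ , _ , _ , eqp)
      ... | e1 with IsWith⇒switched (vside y) p' eqp (subst IsWith (vpos⇒V y p' e1) isw)
      ... | e2 = ⊥-elim (off (subst (_∈ vs) (trans (vpos⇒V y p' e1) (cong (λ z → V z p') e2)) y∈))

      ¬crossing : ∀ t {a b} → a ∈ vs → InSubtree t a → b ∈ vs → ¬ InSubtree t b → ⊥
      ¬crossing t a∈ pa b∈ npb with two-crossings (InSubtree t) (λ v → ≼-dec _ (vpos v)) cyc a∈ pa b∈ npb
      ... | e , e' , e∈ , e'∈ , ne , cr , cr' = ne (trans (crossing-edge t e e∈ cr) (sym (crossing-edge t e' e'∈ cr')))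

      all-in-subtree : ∀ t {w} → w ∈ vs → InSubtree t w → AllAbove (child t p')
      all-in-subtree t w∈ pw v v∈ with ≼-dec (child t p') (vpos v)
      ... | yes h = h
      ... | no h = ⊥-elim (¬crossing t w∈ pw v∈ h)

    ¬toggled-on-cycle : ∀ (p : Pos A) σ → IsBin (sub p) → IsWith (V σ p) → ¬ V σ p ∈ vs
    ¬toggled-on-cycle p σ bp isW W∈ = descend A root refl ≼root (λ _ _ → ≼root)
      where
        W-above : ∀ {q} → q ≼ p → q ≼ vpos (V σ p)
        W-above h = subst (_ ≼_) (sym (vpos-V σ p)) h
        descend : ∀ F (p' : Pos A) → sub p' ≡ F → p' ≼ p → ¬ AllAbove p'
        descend F p' eqp pp above with ≼-split pp
        ... | inj₁ refl = switched-∉cycle p σ bp above (inj₂ isW) W∈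
        descend (pos n) p' eqp pp above | inj₂ (b , _) = IsBin⇒¬IsAtom b (n , inj₁ eqp)
        descend (neg n) p' eqp pp above | inj₂ (b , _) = IsBin⇒¬IsAtom b (n , inj₂ eqp)
        descend (bin k B₀ C₀) p' eqp pp above | inj₂ (_ , inj₁ h) =
          descend B₀ (child L p') (proj₁ (sub-children p' eqp)) h (Ancestor.all-in-subtree p' eqp above L W∈ (W-above h))
        descend (bin k B₀ C₀) p' eqp pp above | inj₂ (_ , inj₂ h) =
          descend C₀ (child R p') (proj₂ (sub-children p' eqp)) h (Ancestor.all-in-subtree p' eqp above R W∈ (W-above h))

  P3-witness : ∀ (Λ : LinkingSet (idSeq A)) → Λ ⊆ IdNet A → ∀ {λa λb} (ρa ρb : Res A) → Λ λa → Λ λb →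
               λa ≈ idLinking ρa → λb ≈ idLinking ρb → DiffRes ρa ρb →
               Σ[ W ∈ Vertex (idSeq A) ] (Toggles Λ W × ((C : SwitchingCycle (GEdges Λ)) → ¬ OnCycle (GEdges Λ) W C))
  P3-witness Λ hΛ ρa ρb la lb ea eb (q , iq , nq) with diverge A root refl ρa ρb tt q ≼root iq nq
  ... | d@(divergence p _ e a _ _ _) =
    Divergence.vertex d , divergence-toggles Λ ρa ρb la lb ea eb d ,
    λ SC → CycleInG.¬toggled-on-cycle Λ hΛ SC p (withConcl a) (_ , _ , _ , e) (withConcl-IsWith p e a)

  identity-P3 : ∀ (Λ : LinkingSet (idSeq A)) → Λ ⊆ IdNet A
                → (Σ[ λ₁ ∈ Linking (idSeq A) ] Σ[ λ₂ ∈ Linking (idSeq A) ] (Λ λ₁ × Λ λ₂ × ¬ (λ₁ ≈ λ₂)))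
                → Σ[ W ∈ Vertex (idSeq A) ] (Toggles Λ W × ((C : SwitchingCycle (GEdges Λ)) → ¬ OnCycle (GEdges Λ) W C))
  identity-P3 Λ hΛ (λ₁ , λ₂ , l₁ , l₂ , λ₁≉λ₂) with member-idLinking Λ hΛ l₁ | member-idLinking Λ hΛ l₂
  ... | r₁ , e₁ | r₂ , e₂ with compareRes r₁ r₂
  ... | inj₁ diff = P3-witness Λ hΛ r₁ r₂ l₁ l₂ e₁ e₂ diff
  ... | inj₂ (inj₁ diff) = P3-witness Λ hΛ r₂ r₁ l₂ l₁ e₂ e₁ diff
  ... | inj₂ (inj₂ same) = ⊥-elim (λ₁≉λ₂ (≈-trans e₁ (≈-trans (SameRes⇒≈ r₁ r₂ same) (≈-sym e₂))))

  identity-IsProofNet : IsProofNet (idSeq A) (IdNet A)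
  identity-IsProofNet = record
    { linkings = IdNet⇒IsLinking ; P1 = identity-P1 ; P2 = identity-P2 ; P3 = identity-P3 }

lemma8p28 : (A : Formula) → NonAmbiguous A
    → IsProofNet (idSeq A) (IdNet A)
    × ((θ : LinkingSet (idSeq A)) → IsProofNet (idSeq A) θ → θ ≐ IdNet A)
lemma8p28 A na = identity-IsProofNet , identity-unique na
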